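{- Let $h\ge 0$ and let $\ell,m$ be integers with $1\le \ell\le m\le n$ such that $$\mathsf{lcp}_{01}[\ell]<h,\qquad \min(\mathsf{lcp}_{01}[\ell+1],\ldots,\mathsf{lcp}_{01}[m])\ge h \ (\text{vacuous if } \ell=m),\qquad \mathsf{lcp}_{01}[m+1]<h.$$ Then at the end of iteration $h$ of the procedure described in the context, the array $B$ satisfies $$B[\ell]\neq 0,\qquad B[\ell+1]=\cdots=B[m]=0,\qquad B[m+1]\neq 0,$$ and $Z^{(h)}[\ell,m]$ is a block of $Z^{(h)}$.
   Context: Let $\Sigma$ be an alphabet of constant size $\sigma$, extended with two special symbols $\$_0<\$_1$ smaller than every symbol of $\Sigma$. Let $t_0[1,n_0]$ and $t_1[1,n_1]$ be strings with $t_0[n_0]=\$_0$ and $t_1[n_1]=\$_1$, these two symbols occurring nowhere else in either string. For a string $t[1,N]$, $t[i,j]$ denotes $t[i]t[i+1]\cdots t[j]$, with $t[i,j]=t[i,N]$ if $j\ge N$, and $t[i,j]$ empty if $i>j$ or $i>N$; $\prec,\preceq$ denote lexicographic order. For $\delta\in\{0,1\}$: $sa_\delta$ is the suffix array of $t_\delta$ (the permutation of $[1,n_\delta]$ with $t_\delta[sa_\delta[i],n_\delta]\prec t_\delta[sa_\delta[i+1],n_\delta]$); $\mathsf{bwt}_\delta[i]=t_\delta[sa_\delta[i]-1]$ if $sa_\delta[i]>1$ and $\mathsf{bwt}_\delta[i]=t_\delta[n_\delta]$ if $sa_\delta[i]=1$. Let $t_{01}=t_0t_1$, $n=n_0+n_1$,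 let $sa_{01}$ be the suffix array of $t_{01}$. Define $\mathsf{lcp}_{01}[i]$, for $2\le i\le n$, as the length of the longest common prefix of $t_{01}[sa_{01}[i-1],n]$ and $t_{01}[sa_{01}[i],n]$, and set $\mathsf{lcp}_{01}[1]=\mathsf{lcp}_{01}[n+1]=-1$. Procedure. Given $\mathsf{bwt}_0,\mathsf{bwt}_1$, it maintains bit vectors $Z^{(h)}[1,n]$ and an integer array $B[1,n+1]$. Initially (this is "the end of iteration 0") $Z^{(0)}=0^{n_0}1^{n_1}$ and $B=1\,0^{n-1}\,1$. Iteration $h\ge 1$ computes $Z^{(h)}$ from $Z^{(h-1)}$ and updates $B$ as follows. Set $k_0=k_1=1$; for every symbol $c$ (including $\$_0,\$_1$) set $\mathsf{Block\_id}[c]=-1$; for every $c\in\Sigma$ set $F[c]=1+$ (number of occurrences in $\mathsf{bwt}_0$ and $\mathsf{bwt}_1$ of symbols smaller than $c$, the symbols $\$_0,\$_1$ counting as smaller). Then for $k=1,\ldots,n$: (1) if $B[k]\neq 0$ and $B[k]\neq h$, set $\mathsf{id}=k$; (2) let $b=Z^{(h-1)}[k]$, $c=\mathsf{bwt}_b[k_b]$, and increment $k_b$; (3) if $c\in\Sigma$ set $j=F[c]$ and increment $F[c]$, otherwise ($c=\$_b$) set $j=b+1$; (4) set $Z^{(h)}[j]=b$; (5) if $\mathsf{Block\_id}[c]\neq \mathsf{id}$, set $\mathsf{Block\_id}[c]=\mathsf{id}$ and, if $B[j]=0$, set $B[j]=h$. "The end of iteration $h$" refers to the state after this loop. Blocks.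 The $i$-th $0$ of $Z^{(h)}$ is associated with $\mathsf{bwt}_0[i]$ and the $j$-th $1$ with $\mathsf{bwt}_1[j]$; the length-$h$ truncated context of $\mathsf{bwt}_\delta[i]$ is $t_\delta[sa_\delta[i],sa_\delta[i]+h-1]$. A block of $Z^{(h)}$ is a maximal interval of positions of $Z^{(h)}$ whose associated symbols all have the same length-$h$ truncated context. -}

module Defs where

open import Data.Bool using (Bool; true; false; if_then_else_; _∧_; _∨_; not)
open import Data.Nat using (ℕ; zero; suc; _+_; _∸_; _≤_; _<_; _≡ᵇ_; _<ᵇ_; _≤ᵇ_)
open import Data.Integer as ℤ using (ℤ; +_; -[1+_])
open import Data.List using (List; []; _∷_; _++_; length; drop; take; foldl; map; upTo; head)
open import Data.List.Relation.Binary.Lex.Strict using (Lex-<)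
open import Data.Maybe using (fromMaybe)
open import Data.Product using (_×_; _,_; proj₁; proj₂)
open import Relation.Nullary using (¬_; does)
open import Relation.Binary.PropositionalEquality using (_≡_)

-- Symbols are natural numbers: $₀ = 0, $₁ = 1, and the alphabet Σ of
-- size σ is {2, …, σ+1}; the order on symbols is the order on ℕ.
-- Strings are lists; all indices below are 1-based as in the paper.

-- t[i] (1-based; only used for 1 ≤ i ≤ |t|)
at : List ℕ → ℕ → ℕ
at t i = fromMaybe 0 (head (drop (i ∸ 1) t))

suffix : List ℕ → ℕ → List ℕ
suffix t i = drop (i ∸ 1) t

_≺_ : List ℕ → List ℕ → Set
_≺_ = Lex-< _≡_ _<_

record IsSuffixArray (t : List ℕ) (sa : ℕ → ℕ) : Set where
  field
    range  : ∀ i → 1 ≤ i → i ≤ length t → 1 ≤ sa i × sa i ≤ length t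
    inj    : ∀ i j → 1 ≤ i → i ≤ length t → 1 ≤ j → j ≤ length t →
             sa i ≡ sa j → i ≡ j
    sorted : ∀ i → 1 ≤ i → i < length t →
             suffix t (sa i) ≺ suffix t (sa (suc i))

bwt : List ℕ → (ℕ → ℕ) → ℕ → ℕ
bwt t sa i = if 1 <ᵇ sa i then at t (sa i ∸ 1) else at t (length t)

lcpLen : List ℕ → List ℕ → ℕ
lcpLen (x ∷ xs) (y ∷ ys) = if x ≡ᵇ y then suc (lcpLen xs ys) else 0
lcpLen _ _ = 0

lcpArr : List ℕ → (ℕ → ℕ) → ℕ → ℤ
lcpArr t sa i =
  if (i ≡ᵇ 1) ∨ (i ≡ᵇ suc (length t)) then -[1+ 0 ]
  else + lcpLen (suffix t (sa (i ∸ 1))) (suffix t (sa i))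

upd : {A : Set} → (ℕ → A) → ℕ → A → (ℕ → A)
upd f x v y = if y ≡ᵇ x then v else f y

count : (ℕ → Bool) → List ℕ → ℕ
count p [] = 0
count p (x ∷ xs) = if p x then suc (count p xs) else count p xs

range1 : ℕ → List ℕ
range1 N = map suc (upTo N)

record LoopState : Set where
  constructor ⟨_,_,_,_,_,_,_⟩
  field
    k₀ k₁   : ℕ
    F       : ℕ → ℕ
    blockId : ℕ → ℤ
    ident   : ℤ
    Zcur    : ℕ → ℕ
    Bcur    : ℕ → ℕ

-- body of the loop for a given k, in iteration h, reading Z^(h-1) = Zp
loopStep : ℕ → (ℕ → ℕ) → (ℕ → ℕ) → (ℕ → ℕ) → LoopState → ℕ → LoopState
loopStep h Zp bw₀ bw₁ ⟨ k0 , k1 , F , blk , idv , Z , B ⟩ k =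
  let -- (1)
      idv' = if not (B k ≡ᵇ 0) ∧ not (B k ≡ᵇ h) then + k else idv
      b    = Zp k
      c    = if b ≡ᵇ 0 then bw₀ k0 else bw₁ k1
      k0'  = if b ≡ᵇ 0 then suc k0 else k0
      k1'  = if b ≡ᵇ 0 then k1 else suc k1
      -- (3)  (c ∈ Σ iff c ≥ 2)
      inΣ  = 2 ≤ᵇ c
      j    = if inΣ then F c else suc b
      F'   = if inΣ then upd F c (suc (F c)) else F
      Z'   = upd Z j b
      -- (5)
      new  = not (does (blk c ℤ.≟ idv'))
      blk' = if new then upd blk c idv' else blk
      B'   = if new ∧ (B j ≡ᵇ 0) then upd B j h else B
  in ⟨ k0' , k1' , F' , blk' , idv' , Z' , B' ⟩

iteration : ℕ → ℕ → ℕ → (ℕ → ℕ) → (ℕ → ℕ) →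
            (ℕ → ℕ) × (ℕ → ℕ) → (ℕ → ℕ) × (ℕ → ℕ)
iteration h n₀ n₁ bw₀ bw₁ (Zp , B) =
  let n     = n₀ + n₁
      bws   = map bw₀ (range1 n₀) ++ map bw₁ (range1 n₁)
      F₀ c  = suc (count (λ x → x <ᵇ c) bws)
      init  = ⟨ 1 , 1 , F₀ , (λ _ → -[1+ 0 ]) , + 0 , (λ _ → 0) , B ⟩
      final = foldl (loopStep h Zp bw₀ bw₁) init (range1 n)
  in LoopState.Zcur final , LoopState.Bcur final

run : ℕ → ℕ → ℕ → (ℕ → ℕ) → (ℕ → ℕ) → (ℕ → ℕ) × (ℕ → ℕ)
run zero    n₀ n₁ bw₀ bw₁ =
  (λ p → if p ≤ᵇ n₀ then 0 else 1) ,
  (λ k → if (k ≡ᵇ 1) ∨ (k ≡ᵇ suc (n₀ + n₁)) then 1 else 0)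
run (suc h) n₀ n₁ bw₀ bw₁ = iteration (suc h) n₀ n₁ bw₀ bw₁ (run h n₀ n₁ bw₀ bw₁)

rank : (ℕ → ℕ) → ℕ → ℕ → ℕ
rank Z δ p = count (λ q → Z q ≡ᵇ δ) (range1 p)

-- length-h truncated context of the symbol associated with position p of Z:
-- if Z[p] = δ is the i-th δ of Z, this is t_δ[sa_δ[i], sa_δ[i]+h-1]
context : List ℕ → List ℕ → (ℕ → ℕ) → (ℕ → ℕ) → ℕ → (ℕ → ℕ) → ℕ → List ℕ
context t₀ t₁ sa₀ sa₁ h Z p =
  if Z p ≡ᵇ 0 then take h (suffix t₀ (sa₀ (rank Z 0 p)))
              else take h (suffix t₁ (sa₁ (rank Z 1 p)))

SameContext : List ℕ → List ℕ → (ℕ → ℕ) → (ℕ → ℕ) → ℕ → (ℕ → ℕ) → ℕ → ℕ → Set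
SameContext t₀ t₁ sa₀ sa₁ h Z ℓ m =
  ∀ p q → ℓ ≤ p → p ≤ m → ℓ ≤ q → q ≤ m →
  context t₀ t₁ sa₀ sa₁ h Z p ≡ context t₀ t₁ sa₀ sa₁ h Z q

IsBlock : List ℕ → List ℕ → (ℕ → ℕ) → (ℕ → ℕ) → ℕ → ℕ → (ℕ → ℕ) → ℕ → ℕ → Set
IsBlock t₀ t₁ sa₀ sa₁ n h Z ℓ m =
  (1 ≤ ℓ × ℓ ≤ m × m ≤ n) ×
  SameContext t₀ t₁ sa₀ sa₁ h Z ℓ m ×
  (∀ ℓ' m' → 1 ≤ ℓ' → ℓ' ≤ ℓ → m ≤ m' → m' ≤ n →
     SameContext t₀ t₁ sa₀ sa₁ h Z ℓ' m' → ℓ' ≡ ℓ × m' ≡ m)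

module Submission where

-- Write key h g for the first h symbols of the suffix of t₀₁ = t₀t₁
-- starting at g, cut right after its first $-symbol; these are exactly the
-- truncated contexts of t₀ and t₁.  By induction on h we show the invariant:
-- (Z) the symbols associated with Z^(h) are listed in nondecreasing order of
--     length-h context, with n₀ zeros; since the suffix array sa₀₁ lists the
--     same contexts in sorted order, position p of Z^(h) then carries the
--     context key h (sa₀₁ p) ("alignment");
-- (B) B[p] ≠ 0 exactly at the level-h boundaries: p = 1, p = n+1, or the keys
--     of the suffixes sa₀₁[p-1] and sa₀₁[p] differ.
-- For the step, the loop of iteration h sends the k-th entry of Z^(h-1) to a
-- position dest k (a bijection of [1,n], the LF-mapping), where the new
-- context is the symbol read followed by the old context; and the test of
-- step (5) succeeds exactly when dest k is a boundary.  Finally lcp₀₁[i] < h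
-- iff i is a level-h boundary, which gives the statement about B, and the
-- alignment turns constancy of keys on [ℓ,m] into the block property.

open import Defs
open import Data.Bool using (Bool; true; false; if_then_else_; T; not; _∧_; _∨_)
open import Data.Empty using (⊥; ⊥-elim)
open import Data.Integer as ℤ using (ℤ; +_; -[1+_])
open import Data.Integer.Properties using (+-injective)
open import Data.List using (List; []; _∷_; _++_; length; foldl; map; upTo; take; drop; head)
open import Data.List.Properties
  using (foldl-++; map-++; upTo-∷ʳ; length-map; length-upTo; length-++; length-drop; ++-assoc;
         ∷-injective; ∷-injectiveˡ; ∷-injectiveʳ; ≡-dec; take-[])
open import Data.List.Relation.Binary.Lex.Core using (base; halt; this; next)
import Data.List.Relation.Binary.Lex.Strict as Lex
open import Data.List.Relation.Binary.Pointwise using (Pointwise-≡⇒≡)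
open import Data.List.Relation.Unary.All using (All; []; _∷_)
import Data.List.Relation.Unary.All as All
open import Data.List.Relation.Unary.All.Properties using (drop⁺)
open import Data.Maybe using (fromMaybe)
open import Data.Nat
open import Data.Nat.Properties
open import Data.Product using (Σ; _×_; _,_; proj₁; proj₂)
open import Data.Sum using (_⊎_; inj₁; inj₂)
open import Data.Unit using (tt)
open import Relation.Binary using (tri<; tri≈; tri>)
open import Relation.Binary.PropositionalEquality
open import Relation.Nullary using (¬_; Dec; yes; no; does)

data EqbView (m n : ℕ) : Set where
  eqv  : m ≡ n → (m ≡ᵇ n) ≡ true → EqbView m n
  neqv : m ≢ n → (m ≡ᵇ n) ≡ false → EqbView m n

eqbView : ∀ m n → EqbView m n
eqbView m n with m ≡ᵇ n in e
... | true  = eqv (≡ᵇ⇒≡ m n (subst T (sym e) tt)) e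
... | false = neqv (λ p → subst T e (≡⇒≡ᵇ m n p)) e

eqb-refl : ∀ n → (n ≡ᵇ n) ≡ true
eqb-refl n with eqbView n n
... | eqv _ e = e
... | neqv ne _ = ⊥-elim (ne refl)

eqb-true : ∀ {m n} → m ≡ n → (m ≡ᵇ n) ≡ true
eqb-true {m} refl = eqb-refl m

eqb-neq : ∀ {m n} → m ≢ n → (m ≡ᵇ n) ≡ false
eqb-neq {m} {n} ne with eqbView m n
... | eqv e _ = ⊥-elim (ne e)
... | neqv _ e = e

eqb-sound : ∀ {m n} → (m ≡ᵇ n) ≡ true → m ≡ n
eqb-sound {m} {n} e with eqbView m n
... | eqv x _ = x
... | neqv _ b with () ← trans (sym b) e

∧-intro : ∀ {x y : Bool} → x ≡ true → y ≡ true → (x ∧ y) ≡ true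
∧-intro refl refl = refl

∧-left : ∀ {x y : Bool} → (x ∧ y) ≡ true → x ≡ true
∧-left {true} e = refl

∧-right : ∀ {x y : Bool} → (x ∧ y) ≡ true → y ≡ true
∧-right {true} e = e

ltb-view : ∀ m n → ((m <ᵇ n) ≡ true × m < n) ⊎ ((m <ᵇ n) ≡ false × n ≤ m)
ltb-view m n with m <ᵇ n in e
... | true  = inj₁ (refl , <ᵇ⇒< m n (subst T (sym e) tt))
... | false = inj₂ (refl , ≮⇒≥ (λ p → subst T e (<⇒<ᵇ p)))

ltb-true : ∀ {m n} → m < n → (m <ᵇ n) ≡ true
ltb-true {m} {n} p with ltb-view m n
... | inj₁ (e , _) = e
... | inj₂ (_ , q) = ⊥-elim (<⇒≱ p q)

ltb-false : ∀ {m n} → n ≤ m → (m <ᵇ n) ≡ false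
ltb-false {m} {n} p with ltb-view m n
... | inj₁ (_ , q) = ⊥-elim (<⇒≱ q p)
... | inj₂ (e , _) = e

le2-view : ∀ x → ((2 ≤ᵇ x) ≡ true × 2 ≤ x) ⊎ ((2 ≤ᵇ x) ≡ false × x < 2)
le2-view 0 = inj₂ (refl , s≤s z≤n)
le2-view 1 = inj₂ (refl , s≤s (s≤s z≤n))
le2-view (suc (suc x)) = inj₁ (refl , s≤s (s≤s z≤n))

le2-true : ∀ {x} → 2 ≤ x → (2 ≤ᵇ x) ≡ true
le2-true {x} p with le2-view x
... | inj₁ (e , _) = e
... | inj₂ (_ , q) = ⊥-elim (<⇒≱ q p)

le2-false : ∀ {x} → x < 2 → (2 ≤ᵇ x) ≡ false
le2-false {x} p with le2-view x
... | inj₁ (_ , q) = ⊥-elim (<⇒≱ p q)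
... | inj₂ (e , _) = e

zero-or-suc : ∀ x → x ≡ 0 ⊎ Σ ℕ λ m → x ≡ suc m
zero-or-suc zero = inj₁ refl
zero-or-suc (suc m) = inj₂ (m , refl)

pred-pos : ∀ {p} → 2 ≤ p → 1 ≤ p ∸ 1
pred-pos (s≤s (s≤s _)) = s≤s z≤n

range1-suc : ∀ K → range1 (suc K) ≡ range1 K ++ (suc K ∷ [])
range1-suc K = trans (cong (map suc) (sym (upTo-∷ʳ K))) (map-++ suc (upTo K) (K ∷ []))

length-range1 : ∀ N → length (range1 N) ≡ N
length-range1 N = trans (length-map suc (upTo N)) (length-upTo N)

foldl-range1-suc : ∀ {A : Set} (f : A → ℕ → A) (a : A) K →
  foldl f a (range1 (suc K)) ≡ f (foldl f a (range1 K)) (suc K)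
foldl-range1-suc f a K =
  trans (cong (foldl f a) (range1-suc K)) (foldl-++ f a (range1 K) (suc K ∷ []))

upd-eq : ∀ {A : Set} (f : ℕ → A) x v → upd f x v x ≡ v
upd-eq f x v rewrite eqb-refl x = refl

upd-neq : ∀ {A : Set} (f : ℕ → A) x v y → y ≢ x → upd f x v y ≡ f y
upd-neq f x v y ne rewrite eqb-neq ne = refl

count-++ : ∀ p xs ys → count p (xs ++ ys) ≡ count p xs + count p ys
count-++ p [] ys = refl
count-++ p (x ∷ xs) ys with p x
... | true  = cong suc (count-++ p xs ys)
... | false = count-++ p xs ys

count-≤ : ∀ p xs → count p xs ≤ length xs
count-≤ p [] = z≤n
count-≤ p (x ∷ xs) with p x
... | true  = s≤s (count-≤ p xs)
... | false = m≤n⇒m≤1+n (count-≤ p xs)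

-- #{x < c} + #{x = c} = #{x < c+1}: the symbols equal to c come right after
-- the smaller ones in the counting order used to initialise F.
count-split : ∀ c xs →
  count (λ x → x <ᵇ c) xs + count (λ x → x ≡ᵇ c) xs ≡ count (λ x → x <ᵇ suc c) xs
count-split c [] = refl
count-split c (x ∷ xs) with <-cmp x c
... | tri< a _ _ rewrite ltb-true a | eqb-neq (<⇒≢ a) | ltb-true (m≤n⇒m≤1+n a) =
  cong suc (count-split c xs)
... | tri≈ _ refl _ rewrite ltb-false (≤-refl {x}) | eqb-refl x | ltb-true (n<1+n x) =
  trans (+-suc (count (λ y → y <ᵇ x) xs) _) (cong suc (count-split x xs))
... | tri> _ _ c' rewrite ltb-false (<⇒≤ c') | eqb-neq (λ e → <⇒≢ c' (sym e)) | ltb-false c' =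
  count-split c xs

count-lt-mono : ∀ {c c'} → c ≤ c' → ∀ xs →
  count (λ x → x <ᵇ c) xs ≤ count (λ x → x <ᵇ c') xs
count-lt-mono le [] = z≤n
count-lt-mono {c} {c'} le (x ∷ xs) with ltb-view x c | ltb-view x c'
... | inj₁ (e , _) | inj₁ (e' , _) rewrite e | e' = s≤s (count-lt-mono le xs)
... | inj₁ (e , p) | inj₂ (e' , q) = ⊥-elim (<⇒≱ (≤-trans p le) q)
... | inj₂ (e , _) | inj₁ (e' , _) rewrite e | e' = m≤n⇒m≤1+n (count-lt-mono le xs)
... | inj₂ (e , _) | inj₂ (e' , _) rewrite e | e' = count-lt-mono le xs

count-map-snoc : ∀ (P : ℕ → Bool) (f : ℕ → ℕ) N →
  count P (map f (range1 (suc N))) ≡ count P (map f (range1 N)) + count P (f (suc N) ∷ [])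
count-map-snoc P f N =
  trans (cong (λ l → count P (map f l)) (range1-suc N))
    (trans (cong (count P) (map-++ f (range1 N) (suc N ∷ [])))
      (count-++ P (map f (range1 N)) (f (suc N) ∷ [])))

count-hit : ∀ (P : ℕ → Bool) (f : ℕ → ℕ) N r → 1 ≤ r → r ≤ N → P (f r) ≡ true →
  1 ≤ count P (map f (range1 N))
count-hit P f zero (suc r) p () e
count-hit P f (suc N) r p q e with m≤n⇒m<n∨m≡n q
... | inj₁ q' = ≤-trans (count-hit P f N r p (≤-pred q') e)
                  (≤-trans (m≤m+n _ _) (≤-reflexive (sym (count-map-snoc P f N))))
... | inj₂ refl = ≤-trans (last-counts (P (f (suc N))) e)
                    (≤-trans (m≤n+m _ _) (≤-reflexive (sym (count-map-snoc P f N))))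
  where
  last-counts : ∀ bb → bb ≡ true → 1 ≤ (if bb then 1 else 0)
  last-counts true _ = s≤s z≤n

-- The associated symbol of
-- position p of Z is determined by rank Z (Z p) p, so these facts are used
-- throughout to move between positions of Z and positions of bwt₀ / bwt₁.

rank-suc : ∀ Z b K → rank Z b (suc K) ≡ rank Z b K + count (λ q → Z q ≡ᵇ b) (suc K ∷ [])
rank-suc Z b K = trans (cong (count (λ q → Z q ≡ᵇ b)) (range1-suc K)) (count-++ _ (range1 K) _)

rank-suc-eq : ∀ Z b K → Z (suc K) ≡ b → rank Z b (suc K) ≡ suc (rank Z b K)
rank-suc-eq Z b K e rewrite rank-suc Z b K | e | eqb-refl b = +-comm (rank Z b K) 1

rank-suc-neq : ∀ Z b K → Z (suc K) ≢ b → rank Z b (suc K) ≡ rank Z b K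
rank-suc-neq Z b K ne rewrite rank-suc Z b K | eqb-neq ne = +-identityʳ (rank Z b K)

rank-step : ∀ Z b K → rank Z b K ≤ rank Z b (suc K)
rank-step Z b K with Z (suc K) ≟ b
... | yes e = ≤-trans (n≤1+n _) (≤-reflexive (sym (rank-suc-eq Z b K e)))
... | no ne = ≤-reflexive (sym (rank-suc-neq Z b K ne))

rank-mono : ∀ Z b {K K'} → K ≤ K' → rank Z b K ≤ rank Z b K'
rank-mono Z b {K} {zero} z≤n = ≤-refl
rank-mono Z b {K} {suc K'} le with m≤n⇒m<n∨m≡n le
... | inj₂ refl = ≤-refl
... | inj₁ (s≤s lt) = ≤-trans (rank-mono Z b lt) (rank-step Z b K')

rank-lt : ∀ Z b {k k'} → k < k' → Z k' ≡ b → rank Z b k < rank Z b k'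
rank-lt Z b {k} {suc k'} (s≤s le) e =
  ≤-trans (s≤s (rank-mono Z b le)) (≤-reflexive (sym (rank-suc-eq Z b k' e)))

rank-pos : ∀ Z b {k} → 1 ≤ k → Z k ≡ b → 1 ≤ rank Z b k
rank-pos Z b {suc k} _ e = ≤-trans (s≤s z≤n) (≤-reflexive (sym (rank-suc-eq Z b k e)))

rank-reflects-< : ∀ Z b {k k'} → rank Z b k < rank Z b k' → k < k'
rank-reflects-< Z b {k} {k'} lt with k <? k'
... | yes p = p
... | no np = ⊥-elim (<⇒≱ lt (rank-mono Z b (≮⇒≥ np)))

rank-inj : ∀ Z b {k k'} → Z k ≡ b → Z k' ≡ b → rank Z b k ≡ rank Z b k' → k ≡ k'
rank-inj Z b {k} {k'} e e' r with <-cmp k k'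
... | tri< a _ _ = ⊥-elim (<⇒≢ (rank-lt Z b a e') r)
... | tri≈ _ x _ = x
... | tri> _ _ c = ⊥-elim (<⇒≢ (rank-lt Z b c e) (sym r))

rank-sum : ∀ Z K → (∀ q → 1 ≤ q → q ≤ K → Z q ≤ 1) → rank Z 0 K + rank Z 1 K ≡ K
rank-sum Z zero h = refl
rank-sum Z (suc K) h with Z (suc K) in e | h (suc K) (s≤s z≤n) ≤-refl
... | zero | _ rewrite rank-suc-eq Z 0 K e
                     | rank-suc-neq Z 1 K (λ x → 0≢1+n (trans (sym e) x)) =
  cong suc (rank-sum Z K (λ q a b → h q a (m≤n⇒m≤1+n b)))
... | suc zero | _ rewrite rank-suc-eq Z 1 K e
                         | rank-suc-neq Z 0 K (λ x → 1+n≢0 (trans (sym e) x)) =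
  trans (+-suc (rank Z 0 K) (rank Z 1 K))
        (cong suc (rank-sum Z K (λ q a b → h q a (m≤n⇒m≤1+n b))))
... | suc (suc _) | s≤s ()

rank-hit : ∀ Z b K r → 1 ≤ r → r ≤ rank Z b K →
  Σ ℕ λ k → 1 ≤ k × k ≤ K × Z k ≡ b × rank Z b k ≡ r
rank-hit Z b zero (suc r) p1 ()
rank-hit Z b (suc K) r p1 p2 with r ≤? rank Z b K
... | yes le = let (k , a , c , d , e) = rank-hit Z b K r p1 le in k , a , m≤n⇒m≤1+n c , d , e
... | no nle with Z (suc K) ≟ b
...   | yes e = suc K , s≤s z≤n , ≤-refl , e ,
          ≤-antisym (≤-trans (≤-reflexive (rank-suc-eq Z b K e)) (≰⇒> nle)) p2
...   | no ne = ⊥-elim (nle (≤-trans p2 (≤-reflexive (rank-suc-neq Z b K ne))))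

InRange : ℕ → (ℕ → ℕ) → ℕ → Set
InRange N f M = ∀ a → 1 ≤ a → a ≤ N → 1 ≤ f a × f a ≤ M

Injective : ℕ → (ℕ → ℕ) → Set
Injective N f = ∀ a b → 1 ≤ a → a ≤ N → 1 ≤ b → b ≤ N → f a ≡ f b → a ≡ b

pigeonhole : ∀ N f → InRange (suc N) f N → Injective (suc N) f → ⊥
pigeonhole zero f r i = let (p , q) = r 1 ≤-refl (s≤s z≤n) in <⇒≱ p q
pigeonhole (suc N) f r i = pigeonhole N g rg ig
  where
  -- redirect the value N+1 to the value of the last argument
  y = f (suc (suc N))
  sel : ∀ {v : ℕ} → Dec (v ≡ suc N) → ℕ
  sel (yes _) = y
  sel {v} (no _) = v
  g : ℕ → ℕ
  g a = sel (f a ≟ suc N)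
  ry = r (suc (suc N)) (s≤s z≤n) ≤-refl
  fy : ∀ a → 1 ≤ a → a ≤ suc N → f a ≢ y
  fy a p q e = <⇒≢ (s≤s q) (i a (suc (suc N)) p (m≤n⇒m≤1+n q) (s≤s z≤n) ≤-refl e)
  rg : InRange (suc N) g N
  rg a p q with f a ≟ suc N
  ... | yes e = proj₁ ry , ≤-pred (≤∧≢⇒< (proj₂ ry) (λ e' → fy a p q (trans e (sym e'))))
  ... | no ne = let (u , v) = r a p (m≤n⇒m≤1+n q) in u , ≤-pred (≤∧≢⇒< v ne)
  ig : Injective (suc N) g
  ig a b pa qa pb qb with f a ≟ suc N | f b ≟ suc N
  ... | yes e | yes e' = λ _ → i a b pa (m≤n⇒m≤1+n qa) pb (m≤n⇒m≤1+n qb) (trans e (sym e'))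
  ... | yes e | no ne' = λ eq → ⊥-elim (fy b pb qb (sym eq))
  ... | no ne | yes e' = λ eq → ⊥-elim (fy a pa qa eq)
  ... | no ne | no ne' = i a b pa (m≤n⇒m≤1+n qa) pb (m≤n⇒m≤1+n qb)

search : ∀ (f : ℕ → ℕ) x K →
  (Σ ℕ λ a → 1 ≤ a × a ≤ K × f a ≡ x) ⊎ (∀ a → 1 ≤ a → a ≤ K → f a ≢ x)
search f x zero = inj₂ (λ { (suc a) p () })
search f x (suc K) with f (suc K) ≟ x
... | yes e = inj₁ (suc K , s≤s z≤n , ≤-refl , e)
... | no ne with search f x K
...   | inj₁ (a , p , q , e) = inj₁ (a , p , m≤n⇒m≤1+n q , e)
...   | inj₂ h = inj₂ λ a p q → below-or-last a p q
  where
  below-or-last : ∀ a → 1 ≤ a → a ≤ suc K → f a ≢ x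
  below-or-last a p q with m≤n⇒m<n∨m≡n q
  ... | inj₁ lt = h a p (≤-pred lt)
  ... | inj₂ refl = ne

surjective : ∀ N f → InRange N f N → Injective N f → ∀ x → 1 ≤ x → x ≤ N →
  Σ ℕ λ a → 1 ≤ a × a ≤ N × f a ≡ x
surjective zero f r i x px qx = ⊥-elim (<⇒≱ px qx)
surjective (suc N') f r i x px qx with search f x (suc N')
... | inj₁ s = s
... | inj₂ missed = ⊥-elim (pigeonhole N' g rg ig)
  where
  -- if x is missed, squeezing out the value x gives an injection into [1,N']
  above : ∀ a → 1 ≤ a → a ≤ suc N' → ¬ (f a < x) → x < f a
  above a p q nlt = ≤∧≢⇒< (≮⇒≥ nlt) (λ e → missed a p q (sym e))
  pred-suc : ∀ a → 1 ≤ a → a ≤ suc N' → ¬ (f a < x) → suc (pred (f a)) ≡ f a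
  pred-suc a p q nlt = suc-pred (f a) {{>-nonZero (≤-trans (s≤s z≤n) (above a p q nlt))}}
  sel : ∀ {v : ℕ} → Dec (v < x) → ℕ
  sel {v} (yes _) = v
  sel {v} (no _) = pred v
  g : ℕ → ℕ
  g a = sel (f a <? x)
  rg : InRange (suc N') g N'
  rg a p q with f a <? x | r a p q
  ... | yes lt | (u , v) = u , ≤-pred (≤-trans lt qx)
  ... | no nlt | (u , v) =
    ≤-pred (≤-trans (s≤s px) (≤-trans (above a p q nlt) (≤-reflexive (sym (pred-suc a p q nlt))))) ,
    ≤-pred (≤-trans (≤-reflexive (pred-suc a p q nlt)) v)
  ig : Injective (suc N') g
  ig a b pa qa pb qb eq with f a <? x | f b <? x
  ... | yes _ | yes _ = i a b pa qa pb qb eq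
  ... | no na | no nb =
    i a b pa qa pb qb (trans (sym (pred-suc a pa qa na)) (trans (cong suc eq) (pred-suc b pb qb nb)))
  ... | yes ya | no nb = ⊥-elim (<⇒≱ ya (≤-trans (≤-pred (≤-trans (above b pb qb nb)
                           (≤-reflexive (sym (pred-suc b pb qb nb))))) (≤-reflexive (sym eq))))
  ... | no na | yes yb = ⊥-elim (<⇒≱ yb (≤-trans (≤-pred (≤-trans (above a pa qa na)
                           (≤-reflexive (sym (pred-suc a pa qa na))))) (≤-reflexive eq)))

StrictlyIncreasing : ℕ → (ℕ → ℕ) → Set
StrictlyIncreasing N f = ∀ a → 1 ≤ a → suc a ≤ N → f a < f (suc a)

incr-lower : ∀ N f → StrictlyIncreasing N f → (∀ a → 1 ≤ a → a ≤ N → 1 ≤ f a) →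
  ∀ a → 1 ≤ a → a ≤ N → a ≤ f a
incr-lower N f s pos (suc zero) p q = pos 1 p q
incr-lower N f s pos (suc (suc a)) p q =
  ≤-trans (s≤s (incr-lower N f s pos (suc a) (s≤s z≤n) (≤-trans (n≤1+n _) q))) (s (suc a) (s≤s z≤n) q)

incr-upper : ∀ N M f → StrictlyIncreasing N f → (∀ a → 1 ≤ a → a ≤ N → f a ≤ M) →
  ∀ d a → 1 ≤ a → a + d ≤ N → f a + d ≤ M
incr-upper N M f s ub zero a p q =
  ≤-trans (≤-reflexive (+-identityʳ _)) (ub a p (≤-trans (≤-reflexive (sym (+-identityʳ a))) q))
incr-upper N M f s ub (suc d) a p q =
  ≤-trans (≤-reflexive (+-suc (f a) d))
    (≤-trans (+-monoˡ-≤ d (s a p (≤-trans (≤-trans (s≤s (m≤m+n a d)) (≤-reflexive (sym (+-suc a d)))) q)))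
      (incr-upper N M f s ub d (suc a) (s≤s z≤n) (≤-trans (≤-reflexive (sym (+-suc a d))) q)))

incr-identity : ∀ N f → StrictlyIncreasing N f → InRange N f N → ∀ a → 1 ≤ a → a ≤ N → f a ≡ a
incr-identity N f s r a p q = ≤-antisym
  (+-cancelʳ-≤ (N ∸ a) (f a) a
     (≤-trans (incr-upper N N f s (λ b x y → proj₂ (r b x y)) (N ∸ a) a p (≤-reflexive (m+[n∸m]≡n q)))
       (≤-reflexive (sym (m+[n∸m]≡n q)))))
  (incr-lower N f s (λ b x y → proj₁ (r b x y)) a p q)

incr-size : ∀ N M f → StrictlyIncreasing N f → InRange N f M → N ≤ M
incr-size zero M f s r = z≤n
incr-size (suc N) M f s r =
  ≤-trans (incr-lower (suc N) f s (λ b x y → proj₁ (r b x y)) (suc N) (s≤s z≤n) ≤-refl)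
          (proj₂ (r (suc N) (s≤s z≤n) ≤-refl))

findLast : (ℕ → Bool) → ℕ → ℕ
findLast P zero = 0
findLast P (suc N) = if P (suc N) then suc N else findLast P N

findLast-spec : ∀ P N i → 1 ≤ i → i ≤ N → P i ≡ true →
  P (findLast P N) ≡ true × 1 ≤ findLast P N × findLast P N ≤ N
findLast-spec P zero (suc i) p () e
findLast-spec P (suc N) i p q e with P (suc N) in eP
... | true = eP , s≤s z≤n , ≤-refl
... | false with m≤n⇒m<n∨m≡n q
...   | inj₂ refl with () ← trans (sym eP) e
...   | inj₁ (s≤s q') = let (a , b , c) = findLast-spec P N i p q' e in a , b , m≤n⇒m≤1+n c

infix 4 _≼_
_≼_ : List ℕ → List ℕ → Set
xs ≼ ys = xs ≺ ys ⊎ xs ≡ ys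

≺-trans : ∀ {xs ys zs} → xs ≺ ys → ys ≺ zs → xs ≺ zs
≺-trans = Lex.<-transitive isEquivalence (resp₂ _<_) <-trans

≺-asym : ∀ {xs ys} → xs ≺ ys → ¬ (ys ≺ xs)
≺-asym = Lex.<-asymmetric sym (resp₂ _<_) <-asym

≺-irrefl : ∀ {xs} → ¬ (xs ≺ xs)
≺-irrefl r = ≺-asym r r

≺-compare : ∀ xs ys → xs ≺ ys ⊎ xs ≡ ys ⊎ ys ≺ xs
≺-compare xs ys with Lex.<-compare sym <-cmp xs ys
... | tri< a _ _ = inj₁ a
... | tri≈ _ e _ = inj₂ (inj₁ (Pointwise-≡⇒≡ e))
... | tri> _ _ c = inj₂ (inj₂ c)

≼-trans : ∀ {xs ys zs} → xs ≼ ys → ys ≼ zs → xs ≼ zs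
≼-trans (inj₁ a) (inj₁ b) = inj₁ (≺-trans a b)
≼-trans (inj₁ a) (inj₂ refl) = inj₁ a
≼-trans (inj₂ refl) b = b

≺-≼-trans : ∀ {xs ys zs} → xs ≺ ys → ys ≼ zs → xs ≺ zs
≺-≼-trans a (inj₁ b) = ≺-trans a b
≺-≼-trans a (inj₂ refl) = a

≼-≺-trans : ∀ {xs ys zs} → xs ≼ ys → ys ≺ zs → xs ≺ zs
≼-≺-trans (inj₁ a) b = ≺-trans a b
≼-≺-trans (inj₂ refl) b = b

≼-antisym : ∀ {xs ys} → xs ≼ ys → ys ≼ xs → xs ≡ ys
≼-antisym (inj₁ a) (inj₁ b) = ⊥-elim (≺-asym a b)
≼-antisym (inj₁ a) (inj₂ e) = sym e
≼-antisym (inj₂ e) _ = e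

≺-head : ∀ {x xs y ys} → (x ∷ xs) ≺ (y ∷ ys) → x ≤ y
≺-head (this a) = <⇒≤ a
≺-head (next refl _) = ≤-refl

≺-tail : ∀ {x xs ys} → (x ∷ xs) ≺ (x ∷ ys) → xs ≺ ys
≺-tail (this a) = ⊥-elim (<-irrefl refl a)
≺-tail (next _ r) = r

≼-cons : ∀ c {xs ys} → xs ≼ ys → (c ∷ xs) ≼ (c ∷ ys)
≼-cons c (inj₁ r) = inj₁ (next refl r)
≼-cons c (inj₂ refl) = inj₂ refl

take-mono : ∀ h {xs ys} → xs ≺ ys → take h xs ≼ take h ys
take-mono zero r = inj₂ refl
take-mono (suc h) (base ())
take-mono (suc h) halt = inj₁ halt
take-mono (suc h) (this a) = inj₁ (this a)
take-mono (suc h) (next refl r) = ≼-cons _ (take-mono h r)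

-- Keys.  cut stops a string right after its first $-symbol; the length-h key
-- of a suffix of t₀t₁ is cut (take h ·).  For a suffix starting inside t₀ this
-- discards the part in t₁, so keys are exactly the truncated contexts.

cut : List ℕ → List ℕ
cut [] = []
cut (x ∷ xs) = x ∷ (if x <ᵇ 2 then [] else cut xs)

cut-mono< : ∀ {xs ys} → xs ≺ ys → cut xs ≼ cut ys
cut-mono< (base ())
cut-mono< halt = inj₁ halt
cut-mono< (this a) = inj₁ (this a)
cut-mono< {x ∷ _} (next refl r) with x <ᵇ 2
... | true = inj₂ refl
... | false = ≼-cons x (cut-mono< r)

cut-mono : ∀ {xs ys} → xs ≼ ys → cut xs ≼ cut ys
cut-mono (inj₁ r) = cut-mono< r
cut-mono (inj₂ refl) = inj₂ refl

key : ℕ → List ℕ → List ℕ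
key h xs = cut (take h xs)

key-mono : ∀ h {xs ys} → xs ≺ ys → key h xs ≼ key h ys
key-mono h r = cut-mono (take-mono h r)

lcp-take : ∀ h xs ys → h ≤ lcpLen xs ys → take h xs ≡ take h ys
lcp-take zero xs ys _ = refl
lcp-take (suc h) (x ∷ xs) (y ∷ ys) le with x ≡ᵇ y in e
... | true rewrite eqb-sound {x} {y} e = cong (y ∷_) (lcp-take h xs ys (≤-pred le))
lcp-take (suc h) [] ys ()
lcp-take (suc h) (x ∷ xs) [] ()

take-take : ∀ a b (xs : List ℕ) → a ≤ b → take a (take b xs) ≡ take a xs
take-take zero b xs _ = refl
take-take (suc a) (suc b) [] _ = refl
take-take (suc a) (suc b) (x ∷ xs) (s≤s le) = cong (x ∷_) (take-take a b xs le)

drop-in : ∀ (a r : List ℕ) k → k ≤ length a → drop k (a ++ r) ≡ drop k a ++ r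
drop-in a r zero _ = refl
drop-in (x ∷ a) r (suc k) (s≤s le) = drop-in a r k le

drop-past : ∀ (a r : List ℕ) k → drop (length a + k) (a ++ r) ≡ drop k r
drop-past [] r k = refl
drop-past (x ∷ a) r k = drop-past a r k

-- distinct starting positions give distinct suffixes (they have distinct lengths)
suffix-injective : ∀ (t : List ℕ) x y → 1 ≤ x → x ≤ length t → 1 ≤ y → y ≤ length t →
  suffix t x ≡ suffix t y → x ≡ y
suffix-injective t (suc x) (suc y) _ qx _ qy e =
  cong suc (+-cancelˡ-≡ (length (suffix t (suc x))) x y
    (trans (len+start x (≤-trans (n≤1+n x) qx))
      (trans (sym (len+start y (≤-trans (n≤1+n y) qy))) (cong (λ l → length l + y) (sym e)))))
  where
  len+start : ∀ x → x ≤ length t → length (suffix t (suc x)) + x ≡ length t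
  len+start x le = trans (cong (_+ x) (length-drop x t)) (m∸n+n≡m le)

drop-cons : ∀ (l : List ℕ) k → k < length l → Σ ℕ λ y → drop k l ≡ y ∷ drop (suc k) l
drop-cons (y ∷ l) zero _ = y , refl
drop-cons (y ∷ l) (suc k) (s≤s q) = drop-cons l k q

DollarFree : List ℕ → Set
DollarFree = All (λ c → 2 ≤ c)

module Terminated (a : List ℕ) (d : ℕ) (free : DollarFree a) (d<2 : d < 2) where
  t : List ℕ
  t = a ++ d ∷ []

  len : length t ≡ suc (length a)
  len = trans (length-++ a) (+-comm (length a) 1)

  len≥1 : 1 ≤ length t
  len≥1 = subst (1 ≤_) (sym len) (s≤s z≤n)

  suf-split : ∀ x → 1 ≤ x → x ≤ length t → suffix t x ≡ drop (x ∸ 1) a ++ d ∷ []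
  suf-split (suc x) _ le = drop-in a (d ∷ []) x (≤-pred (subst (suc x ≤_) len le))

  suf-cons : ∀ x → 1 ≤ x → x ≤ length t → suffix t x ≡ at t x ∷ suffix t (suc x)
  suf-cons (suc x) _ le with drop-cons t x le
  ... | y , e rewrite e = refl

  at-sigma : ∀ x → 1 ≤ x → x < length t → 2 ≤ at t x
  at-sigma (suc x) _ q = go a free x (≤-pred (subst (suc (suc x) ≤_) len q))
    where
    go : ∀ (l : List ℕ) → DollarFree l → ∀ k → k < length l →
         2 ≤ fromMaybe 0 (head (drop k (l ++ d ∷ [])))
    go (y ∷ l) (p ∷ _) zero _ = p
    go (y ∷ l) (_ ∷ bl) (suc k) (s≤s q) = go l bl k q

  at-last : at t (length t) ≡ d
  at-last rewrite len = go a
    where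
    go : ∀ (l : List ℕ) → fromMaybe 0 (head (drop (length l) (l ++ d ∷ []))) ≡ d
    go [] = refl
    go (y ∷ l) = go l

  suf-last : suffix t (length t) ≡ d ∷ []
  suf-last rewrite len = go a
    where
    go : ∀ (l : List ℕ) → drop (length l) (l ++ d ∷ []) ≡ d ∷ []
    go [] = refl
    go (y ∷ l) = go l

  cyc-pred : ℕ → ℕ
  cyc-pred y = if 1 <ᵇ y then y ∸ 1 else length t

  cyc-succ : ℕ → ℕ
  cyc-succ x = if x <ᵇ length t then suc x else 1

  pred-succ : ∀ x → 1 ≤ x → x ≤ length t → cyc-pred (cyc-succ x) ≡ x
  pred-succ x p q with ltb-view x (length t)
  ... | inj₁ (e , _) rewrite e with x
  ...   | suc x' = refl
  pred-succ x p q | inj₂ (e , r) rewrite e = ≤-antisym r q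

  succ-pred : ∀ y → 1 ≤ y → y ≤ length t → cyc-succ (cyc-pred y) ≡ y
  succ-pred y p q with ltb-view 1 y
  ... | inj₁ (e , r) rewrite e with y | r
  ...   | suc y' | s≤s r' rewrite ltb-true {y'} {length t} q = refl
  succ-pred y p q | inj₂ (e , r) rewrite e with ltb-view (length t) (length t)
  ... | inj₁ (_ , w) = ⊥-elim (<-irrefl refl w)
  ... | inj₂ (e' , _) rewrite e' = ≤-antisym p r

  succ-range : ∀ x → 1 ≤ x → x ≤ length t → 1 ≤ cyc-succ x × cyc-succ x ≤ length t
  succ-range x p q with ltb-view x (length t)
  ... | inj₁ (e , r) rewrite e = s≤s z≤n , r
  ... | inj₂ (e , r) rewrite e = s≤s z≤n , len≥1

  pred-range : ∀ y → 1 ≤ y → y ≤ length t → 1 ≤ cyc-pred y × cyc-pred y ≤ length t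
  pred-range y p q with ltb-view 1 y
  ... | inj₁ (e , r) rewrite e = m<n⇒0<n∸m r , ≤-trans (m∸n≤m y 1) q
  ... | inj₂ (e , r) rewrite e = len≥1 , ≤-refl

  suf-pred : ∀ y → 1 ≤ y → y ≤ length t → 2 ≤ at t (cyc-pred y) →
    suffix t (cyc-pred y) ≡ at t (cyc-pred y) ∷ suffix t y
  suf-pred y p q b with ltb-view 1 y
  ... | inj₁ (e , r) rewrite e with y | r
  ...   | suc y' | s≤s r' = suf-cons y' r' (≤-trans (n≤1+n y') q)
  suf-pred y p q b | inj₂ (e , r) rewrite e | at-last = ⊥-elim (<⇒≱ d<2 b)

  pred-dollar : ∀ y → 1 ≤ y → y ≤ length t → at t (cyc-pred y) < 2 →
    y ≡ 1 × cyc-pred y ≡ length t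
  pred-dollar y p q s with ltb-view 1 y
  ... | inj₂ (e , r) rewrite e = ≤-antisym r p , refl
  ... | inj₁ (e , r) rewrite e with y | r
  ...   | suc y' | s≤s r' = ⊥-elim (<⇒≱ s (at-sigma y' r' q))

  suf-succ : ∀ x → 1 ≤ x → x ≤ length t → 2 ≤ at t x →
    suffix t x ≡ at t x ∷ suffix t (cyc-succ x)
  suf-succ x p q b2 with succ-range x p q
  ... | (y1 , y2) = subst (λ z → suffix t z ≡ at t z ∷ suffix t (cyc-succ x)) (pred-succ x p q)
                      (suf-pred (cyc-succ x) y1 y2 (subst (λ z → 2 ≤ at t z) (sym (pred-succ x p q)) b2))

  bwt-cyc-pred : ∀ (sa : ℕ → ℕ) i → bwt t sa i ≡ at t (cyc-pred (sa i))
  bwt-cyc-pred sa i with 1 <ᵇ sa i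
  ... | true = refl
  ... | false = refl

  bwt-first : ∀ (sa : ℕ → ℕ) i → sa i ≡ 1 → bwt t sa i ≡ d
  bwt-first sa i e rewrite e = at-last

module SuffixArrayFacts (t : List ℕ) (sa : ℕ → ℕ) (is : IsSuffixArray t sa) where
  open IsSuffixArray is

  sa-range : InRange (length t) sa (length t)
  sa-range = range

  sa-inj : Injective (length t) sa
  sa-inj = inj

  sa-onto : ∀ x → 1 ≤ x → x ≤ length t → Σ ℕ λ r → 1 ≤ r × r ≤ length t × sa r ≡ x
  sa-onto = surjective (length t) sa range inj

  sa-lt : ∀ s s' → 1 ≤ s → s < s' → s' ≤ length t → suffix t (sa s) ≺ suffix t (sa s')
  sa-lt s (suc s') p (s≤s q) r with m≤n⇒m<n∨m≡n q
  ... | inj₂ refl = sorted s p r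
  ... | inj₁ q' = ≺-trans (sa-lt s s' p q' (≤-trans (n≤1+n s') r)) (sorted s' (≤-trans p q) r)

  sa-reflects-< : ∀ r r' → 1 ≤ r → r ≤ length t → 1 ≤ r' → r' ≤ length t →
    suffix t (sa r) ≺ suffix t (sa r') → r < r'
  sa-reflects-< r r' p q p' q' l with <-cmp r r'
  ... | tri< a _ _ = a
  ... | tri≈ _ refl _ = ⊥-elim (≺-irrefl l)
  ... | tri> _ _ c = ⊥-elim (≺-asym l (sa-lt r' r p' c q))

-- Two enumerations A, B of [1,N] that are both sorted by a key κ carry the
-- same key at every position: elements with equal keys may be permuted, but
-- the sequence of keys is determined.
module Alignment (N : ℕ) (κ : ℕ → List ℕ) where
  SortedBy : (ℕ → ℕ) → Set
  SortedBy A = ∀ p p' → 1 ≤ p → p ≤ p' → p' ≤ N → κ (A p) ≼ κ (A p')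

  -- if κ (A p) ≺ κ (B p), then A 1, …, A p, B p, …, B N are N+1 distinct values
  not-below : ∀ A B → InRange N A N → Injective N A → InRange N B N → Injective N B →
    SortedBy A → SortedBy B → ∀ p → 1 ≤ p → p ≤ N → ¬ (κ (A p) ≺ κ (B p))
  not-below A B rA iA rB iB sA sB p a b lt = pigeonhole N F rF iF
    where
    sel : ∀ {q : ℕ} → Dec (q ≤ p) → ℕ
    sel {q} (yes _) = A q
    sel {q} (no _) = B (q ∸ 1)
    F : ℕ → ℕ
    F q = sel (q ≤? p)
    below-pred : ∀ {v} → p < v → 1 ≤ v ∸ 1
    below-pred {suc v} (s≤s w) = ≤-trans a w
    lo : ∀ q → 1 ≤ q → q ≤ p → κ (A q) ≺ κ (B p)
    lo q x y = ≼-≺-trans (sA q p x y b) lt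
    hi : ∀ q → p < q → q ≤ suc N → κ (B p) ≼ κ (B (q ∸ 1))
    hi (suc q) (s≤s x) y = sB p q a x (≤-pred y)
    rF : InRange (suc N) F N
    rF q x y with q ≤? p
    ... | yes le = rA q x (≤-trans le b)
    ... | no nle = rB (q ∸ 1) (below-pred (≰⇒> nle)) (∸-monoˡ-≤ 1 y)
    iF : Injective (suc N) F
    iF q q' x y x' y' with q ≤? p | q' ≤? p
    ... | yes u | yes u' = iA q q' x (≤-trans u b) x' (≤-trans u' b)
    ... | no u | no u' = λ e → shift-injective (≰⇒> u) (≰⇒> u')
            (iB (q ∸ 1) (q' ∸ 1) (below-pred (≰⇒> u)) (∸-monoˡ-≤ 1 y) (below-pred (≰⇒> u')) (∸-monoˡ-≤ 1 y') e)
      where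
      shift-injective : ∀ {v v'} → p < v → p < v' → v ∸ 1 ≡ v' ∸ 1 → v ≡ v'
      shift-injective {suc v} {suc v'} _ _ e = cong suc e
    ... | yes u | no u' = λ e → ⊥-elim (≺-irrefl (≺-≼-trans (lo q x u)
            (subst (λ z → κ (B p) ≼ κ z) (sym e) (hi q' (≰⇒> u') y'))))
    ... | no u | yes u' = λ e → ⊥-elim (≺-irrefl (≺-≼-trans (lo q' x' u')
            (subst (λ z → κ (B p) ≼ κ z) e (hi q (≰⇒> u) y))))

  aligned : ∀ A B → InRange N A N → Injective N A → InRange N B N → Injective N B →
    SortedBy A → SortedBy B → ∀ p → 1 ≤ p → p ≤ N → κ (A p) ≡ κ (B p)
  aligned A B rA iA rB iB sA sB p a b with ≺-compare (κ (A p)) (κ (B p))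
  ... | inj₁ l = ⊥-elim (not-below A B rA iA rB iB sA sB p a b l)
  ... | inj₂ (inj₁ e) = e
  ... | inj₂ (inj₂ l) = ⊥-elim (not-below B A rB iB rA iA sB sA p a b l)

module Setting (u₀ u₁ : List ℕ) (free₀ : DollarFree u₀) (free₁ : DollarFree u₁)
  (sa₀ sa₁ sa₀₁ : ℕ → ℕ)
  (isa₀ : IsSuffixArray (u₀ ++ 0 ∷ []) sa₀) (isa₁ : IsSuffixArray (u₁ ++ 1 ∷ []) sa₁)
  (isa₀₁ : IsSuffixArray ((u₀ ++ 0 ∷ []) ++ (u₁ ++ 1 ∷ [])) sa₀₁) where

  t₀ t₁ t₀₁ : List ℕ
  t₀ = u₀ ++ 0 ∷ []
  t₁ = u₁ ++ 1 ∷ []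
  t₀₁ = t₀ ++ t₁

  n₀ n₁ n : ℕ
  n₀ = length t₀
  n₁ = length t₁
  n = n₀ + n₁

  module T₀ = Terminated u₀ 0 free₀ (s≤s z≤n)
  module T₁ = Terminated u₁ 1 free₁ (s≤s (s≤s z≤n))
  module SA₀ = SuffixArrayFacts t₀ sa₀ isa₀
  module SA₁ = SuffixArrayFacts t₁ sa₁ isa₁
  module SA₀₁ = SuffixArrayFacts t₀₁ sa₀₁ isa₀₁

  length-t₀₁ : length t₀₁ ≡ n
  length-t₀₁ = length-++ t₀

  n₀≥1 : 1 ≤ n₀
  n₀≥1 = T₀.len≥1

  n₁≥1 : 1 ≤ n₁
  n₁≥1 = T₁.len≥1

  n≥2 : 2 ≤ n
  n≥2 = +-mono-≤ n₀≥1 n₁≥1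

  -- Suffixes of t₀₁: a $₀ t₁ or a $₁ with a ∈ Σ*.  Two of them are equal as
  -- soon as they agree up to and including their first $-symbol.

  SuffixShape : List ℕ → Set
  SuffixShape xs = (Σ (List ℕ) λ a → DollarFree a × xs ≡ a ++ 0 ∷ t₁)
                 ⊎ (Σ (List ℕ) λ a → DollarFree a × xs ≡ a ++ 1 ∷ [])

  shape-tail : ∀ {x xs} → SuffixShape (x ∷ xs) → 2 ≤ x → SuffixShape xs
  shape-tail (inj₁ ([] , _ , e)) p with proj₁ (∷-injective e)
  ... | refl = ⊥-elim (<⇒≱ (s≤s z≤n) p)
  shape-tail (inj₁ (y ∷ a , _ ∷ ba , e)) p = inj₁ (a , ba , proj₂ (∷-injective e))
  shape-tail (inj₂ ([] , _ , e)) p with proj₁ (∷-injective e)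
  ... | refl = ⊥-elim (<⇒≱ (s≤s (s≤s z≤n)) p)
  shape-tail (inj₂ (y ∷ a , _ ∷ ba , e)) p = inj₂ (a , ba , proj₂ (∷-injective e))

  shape-after-dollar : ∀ {x xs ys} → SuffixShape (x ∷ xs) → SuffixShape (x ∷ ys) → x < 2 → xs ≡ ys
  shape-after-dollar {x} gx gy p = trans (rest gx) (sym (rest gy))
    where
    rest : ∀ {zs} → SuffixShape (x ∷ zs) → zs ≡ (if x ≡ᵇ 0 then t₁ else [])
    rest (inj₁ ([] , _ , e)) with ∷-injective e
    ... | refl , e2 = e2
    rest (inj₁ (y ∷ a , py ∷ _ , e)) with ∷-injective e
    ... | refl , _ = ⊥-elim (<⇒≱ p py)
    rest (inj₂ ([] , _ , e)) with ∷-injective e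
    ... | refl , e2 = e2
    rest (inj₂ (y ∷ a , py ∷ _ , e)) with ∷-injective e
    ... | refl , _ = ⊥-elim (<⇒≱ p py)

  shape-nonempty : ∀ {xs} → SuffixShape xs → Σ ℕ λ x → Σ (List ℕ) λ xs' → xs ≡ x ∷ xs'
  shape-nonempty (inj₁ ([] , _ , refl)) = _ , _ , refl
  shape-nonempty (inj₁ (y ∷ a , _ , refl)) = _ , _ , refl
  shape-nonempty (inj₂ ([] , _ , refl)) = _ , _ , refl
  shape-nonempty (inj₂ (y ∷ a , _ , refl)) = _ , _ , refl

  key-inj : ∀ h xs ys → SuffixShape xs → SuffixShape ys → key h xs ≡ key h ys → take h xs ≡ take h ys
  key-inj zero xs ys gx gy e = refl
  key-inj (suc h) xs ys gx gy e with shape-nonempty gx | shape-nonempty gy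
  ... | x , xs' , refl | y , ys' , refl with ∷-injective e
  ... | refl , e2 with ltb-view x 2
  ...   | inj₁ (b , p) = cong (λ l → x ∷ take h l) (shape-after-dollar gx gy p)
  ...   | inj₂ (b , p) rewrite b =
    cong (x ∷_) (key-inj h xs' ys' (shape-tail gx p) (shape-tail gy p) e2)

  take-lcp : ∀ h xs ys → SuffixShape xs → SuffixShape ys → xs ≢ ys →
    take h xs ≡ take h ys → h ≤ lcpLen xs ys
  take-lcp zero xs ys gx gy ne e = z≤n
  take-lcp (suc h) xs ys gx gy ne e with shape-nonempty gx | shape-nonempty gy
  ... | x , xs' , refl | y , ys' , refl with ∷-injective e
  ... | refl , e2 with ltb-view x 2
  ...   | inj₁ (b , p) = ⊥-elim (ne (cong (x ∷_) (shape-after-dollar gx gy p)))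
  ...   | inj₂ (b , p) rewrite eqb-refl x =
    s≤s (take-lcp h xs' ys' (shape-tail gx p) (shape-tail gy p) (λ q → ne (cong (x ∷_) q)) e2)

  t₀₁-shape : t₀₁ ≡ u₀ ++ 0 ∷ t₁
  t₀₁-shape = ++-assoc u₀ (0 ∷ []) t₁

  suffix-shape : ∀ g → 1 ≤ g → g ≤ n → SuffixShape (suffix t₀₁ g)
  suffix-shape (suc k) _ le with k ≤? length u₀
  ... | yes kle = inj₁ (drop k u₀ , drop⁺ k free₀ ,
                        trans (cong (drop k) t₀₁-shape) (drop-in u₀ (0 ∷ t₁) k kle))
  ... | no nkle = inj₂ (drop k' u₁ , drop⁺ k' free₁ , eq)
    where
    k' = k ∸ suc (length u₀)
    kk : k ≡ length u₀ + suc k'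
    kk = trans (sym (m+[n∸m]≡n (≰⇒> nkle))) (sym (+-suc (length u₀) k'))
    lnn : n ≡ length u₀ + suc (suc (length u₁))
    lnn = trans (cong (_+ n₁) T₀.len)
            (trans (cong (λ z → suc (length u₀) + z) T₁.len) (sym (+-suc (length u₀) (suc (length u₁)))))
    k'le : k' ≤ length u₁
    k'le = ≤-pred (≤-pred (+-cancelˡ-≤ (length u₀) _ _
             (subst₂ _≤_ (trans (cong suc kk) (sym (+-suc (length u₀) (suc k')))) lnn le)))
    eq : drop k t₀₁ ≡ drop k' u₁ ++ 1 ∷ []
    eq = trans (cong (drop k) t₀₁-shape) (trans (cong (λ z → drop z (u₀ ++ 0 ∷ t₁)) kk)
           (trans (drop-past u₀ (0 ∷ t₁) (suc k')) (drop-in u₁ (1 ∷ []) k' k'le)))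

  key-of : ℕ → ℕ → List ℕ
  key-of h g = key h (suffix t₀₁ g)

  cut-after-$₀ : ∀ h a r → DollarFree a → take h (a ++ 0 ∷ []) ≡ cut (take h ((a ++ 0 ∷ []) ++ r))
  cut-after-$₀ zero a r _ = refl
  cut-after-$₀ (suc zero) [] r _ = refl
  cut-after-$₀ (suc (suc h)) [] r _ = refl
  cut-after-$₀ (suc h) (x ∷ a) r (px ∷ ba) rewrite ltb-false {x} {2} px =
    cong (x ∷_) (cut-after-$₀ h a r ba)

  cut-after-$₁ : ∀ h a → DollarFree a → take h (a ++ 1 ∷ []) ≡ cut (take h (a ++ 1 ∷ []))
  cut-after-$₁ zero a _ = refl
  cut-after-$₁ (suc zero) [] _ = refl
  cut-after-$₁ (suc (suc h)) [] _ = refl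
  cut-after-$₁ (suc h) (x ∷ a) (px ∷ ba) rewrite ltb-false {x} {2} px =
    cong (x ∷_) (cut-after-$₁ h a ba)

  context₀-key : ∀ h i → 1 ≤ i → i ≤ n₀ → take h (suffix t₀ i) ≡ key-of h i
  context₀-key h (suc k) p q
    rewrite drop-in t₀ t₁ k (≤-trans (n≤1+n k) q) | T₀.suf-split (suc k) p q =
    cut-after-$₀ h (drop k u₀) t₁ (drop⁺ k free₀)

  context₁-key : ∀ h i → 1 ≤ i → i ≤ n₁ → take h (suffix t₁ i) ≡ key-of h (n₀ + i)
  context₁-key h (suc k) p q
    rewrite +-suc n₀ k | drop-past t₀ t₁ k | T₁.suf-split (suc k) p q =
    cut-after-$₁ h (drop k u₁) (drop⁺ k free₁)

  -- Bit vectors and the contexts they induce.  origin Z p is the position in t₀₁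
  -- of the suffix associated with position p of Z: the suffix of t₀ (or of t₁,
  -- shifted by n₀) of the corresponding rank.

  ctx : ℕ → (ℕ → ℕ) → ℕ → List ℕ
  ctx h Z p = context t₀ t₁ sa₀ sa₁ h Z p

  origin : (ℕ → ℕ) → ℕ → ℕ
  origin Z p = if Z p ≡ᵇ 0 then sa₀ (rank Z 0 p) else n₀ + sa₁ (rank Z 1 p)

  Binary : (ℕ → ℕ) → Set
  Binary Z = ∀ p → 1 ≤ p → p ≤ n → Z p ≤ 1

  SortedContexts : ℕ → (ℕ → ℕ) → Set
  SortedContexts h Z = ∀ p p' → 1 ≤ p → p ≤ p' → p' ≤ n → ctx h Z p ≼ ctx h Z p'

  record ZInvariant (h : ℕ) (Z : ℕ → ℕ) : Set where
    field
      binary : Binary Z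
      zeros  : rank Z 0 n ≡ n₀
      sorted : SortedContexts h Z

  t₀-before-t₁ : ∀ {x y} → x ≤ n₀ → 1 ≤ y → x < n₀ + y
  t₀-before-t₁ {x} {y} p q = ≤-trans (s≤s p) (≤-trans (≤-reflexive (+-comm 1 n₀)) (+-monoʳ-≤ n₀ q))

  module BitVector {Z : ℕ → ℕ} (binary : Binary Z) (zeros : rank Z 0 n ≡ n₀) where
    ones : rank Z 1 n ≡ n₁
    ones = +-cancelˡ-≡ n₀ _ _ (trans (cong (_+ rank Z 1 n) (sym zeros)) (rank-sum Z n binary))

    bit : ∀ p → 1 ≤ p → p ≤ n → Z p ≡ 0 ⊎ Z p ≡ 1
    bit p a b with Z p | binary p a b
    ... | zero | _ = inj₁ refl
    ... | suc zero | _ = inj₂ refl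
    ... | suc (suc _) | s≤s ()

    rank₀-range : ∀ p → 1 ≤ p → p ≤ n → Z p ≡ 0 → 1 ≤ rank Z 0 p × rank Z 0 p ≤ n₀
    rank₀-range p a b e = rank-pos Z 0 a e , subst (rank Z 0 p ≤_) zeros (rank-mono Z 0 b)

    rank₁-range : ∀ p → 1 ≤ p → p ≤ n → Z p ≡ 1 → 1 ≤ rank Z 1 p × rank Z 1 p ≤ n₁
    rank₁-range p a b e = rank-pos Z 1 a e , subst (rank Z 1 p ≤_) ones (rank-mono Z 1 b)

    ctx-origin : ∀ h p → 1 ≤ p → p ≤ n → ctx h Z p ≡ key-of h (origin Z p)
    ctx-origin h p a b with bit p a b
    ... | inj₁ e rewrite e = let (c , d) = rank₀-range p a b e ; (x , y) = SA₀.sa-range _ c d in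
      context₀-key h (sa₀ (rank Z 0 p)) x y
    ... | inj₂ e rewrite e = let (c , d) = rank₁-range p a b e ; (x , y) = SA₁.sa-range _ c d in
      context₁-key h (sa₁ (rank Z 1 p)) x y

    origin-range : InRange n (origin Z) n
    origin-range p a b with bit p a b
    ... | inj₁ e rewrite e = let (c , d) = rank₀-range p a b e ; (x , y) = SA₀.sa-range _ c d in
      x , ≤-trans y (m≤m+n n₀ n₁)
    ... | inj₂ e rewrite e = let (c , d) = rank₁-range p a b e ; (x , y) = SA₁.sa-range _ c d in
      ≤-trans x (m≤n+m _ n₀) , +-monoʳ-≤ n₀ y

    origin-inj : Injective n (origin Z)
    origin-inj p p' a b a' b' with bit p a b | bit p' a' b'
    ... | inj₁ e | inj₁ e' rewrite e | e' = λ eq →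
      let (c , d) = rank₀-range p a b e ; (c' , d') = rank₀-range p' a' b' e' in
      rank-inj Z 0 e e' (SA₀.sa-inj _ _ c d c' d' eq)
    ... | inj₂ e | inj₂ e' rewrite e | e' = λ eq →
      let (c , d) = rank₁-range p a b e ; (c' , d') = rank₁-range p' a' b' e' in
      rank-inj Z 1 e e' (SA₁.sa-inj _ _ c d c' d' (+-cancelˡ-≡ n₀ _ _ eq))
    ... | inj₁ e | inj₂ e' rewrite e | e' = λ eq →
      let (c , d) = rank₀-range p a b e ; (c' , d') = rank₁-range p' a' b' e' in
      ⊥-elim (<⇒≢ (t₀-before-t₁ (proj₂ (SA₀.sa-range _ c d)) (proj₁ (SA₁.sa-range _ c' d'))) eq)
    ... | inj₂ e | inj₁ e' rewrite e | e' = λ eq →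
      let (c , d) = rank₁-range p a b e ; (c' , d') = rank₀-range p' a' b' e' in
      ⊥-elim (<⇒≢ (t₀-before-t₁ (proj₂ (SA₀.sa-range _ c' d')) (proj₁ (SA₁.sa-range _ c d))) (sym eq))

  sa₀₁-range : InRange n sa₀₁ n
  sa₀₁-range p a b =
    subst (λ m → 1 ≤ sa₀₁ p × sa₀₁ p ≤ m) length-t₀₁ (SA₀₁.sa-range p a (subst (p ≤_) (sym length-t₀₁) b))

  sa₀₁-inj : Injective n sa₀₁
  sa₀₁-inj p q a b c d =
    SA₀₁.sa-inj p q a (subst (p ≤_) (sym length-t₀₁) b) c (subst (q ≤_) (sym length-t₀₁) d)

  sa₀₁-sorted : ∀ h → Alignment.SortedBy n (key-of h) sa₀₁
  sa₀₁-sorted h p p' a b c with m≤n⇒m<n∨m≡n b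
  ... | inj₂ refl = inj₂ refl
  ... | inj₁ lt = key-mono h (SA₀₁.sa-lt p p' a lt (subst (p' ≤_) (sym length-t₀₁) c))

  ctx-aligned : ∀ {h Z} → ZInvariant h Z → ∀ p → 1 ≤ p → p ≤ n → ctx h Z p ≡ key-of h (sa₀₁ p)
  ctx-aligned {h} {Z} inv p a b =
    trans (ctx-origin h p a b)
      (Alignment.aligned n (key-of h) (origin Z) sa₀₁ origin-range origin-inj sa₀₁-range sa₀₁-inj
        (λ q q' x y z → subst₂ _≼_ (ctx-origin h q x (≤-trans y z)) (ctx-origin h q' (≤-trans x y) z)
                          (sorted q q' x y z))
        (sa₀₁-sorted h) p a b)
    where
    open ZInvariant inv
    open BitVector binary zeros

  Boundary : ℕ → ℕ → Set
  Boundary h p = p ≡ 1 ⊎ p ≡ suc n ⊎ (2 ≤ p × p ≤ n × key-of h (sa₀₁ (p ∸ 1)) ≢ key-of h (sa₀₁ p))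

  boundary-keys-differ : ∀ h p → 2 ≤ p → p ≤ n → Boundary h p →
    key-of h (sa₀₁ (p ∸ 1)) ≢ key-of h (sa₀₁ p)
  boundary-keys-differ h p a b (inj₁ refl) = ⊥-elim (<⇒≱ a ≤-refl)
  boundary-keys-differ h p a b (inj₂ (inj₁ refl)) = ⊥-elim (<⇒≱ (s≤s b) ≤-refl)
  boundary-keys-differ h p a b (inj₂ (inj₂ (_ , _ , d))) = d

  module _ {h Z} (inv : ZInvariant h Z) (p : ℕ) (a : 2 ≤ p) (b : p ≤ n) where
    private
      ctx-keys : ctx h Z (p ∸ 1) ≡ ctx h Z p → key-of h (sa₀₁ (p ∸ 1)) ≡ key-of h (sa₀₁ p)
      ctx-keys e = trans (sym (ctx-aligned inv (p ∸ 1) (pred-pos a) (≤-trans (m∸n≤m p 1) b)))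
                     (trans e (ctx-aligned inv p (≤-trans (s≤s z≤n) a) b))

    ctx-differs⇒boundary-at : ctx h Z (p ∸ 1) ≢ ctx h Z p → Boundary h p
    ctx-differs⇒boundary-at d = inj₂ (inj₂ (a , b , λ e → d (trans
      (ctx-aligned inv (p ∸ 1) (pred-pos a) (≤-trans (m∸n≤m p 1) b))
      (trans e (sym (ctx-aligned inv p (≤-trans (s≤s z≤n) a) b))))))

    boundary⇒ctx-differs-at : Boundary h p → ctx h Z (p ∸ 1) ≢ ctx h Z p
    boundary⇒ctx-differs-at bd e = boundary-keys-differ h p a b bd (ctx-keys e)

  key-refine : ∀ a b g g' → a ≤ b → 1 ≤ g → g ≤ n → 1 ≤ g' → g' ≤ n →
    key-of b g ≡ key-of b g' → key-of a g ≡ key-of a g'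
  key-refine a b g g' le p q p' q' e =
    cong cut (trans (sym (take-take a b _ le))
      (trans (cong (take a) (key-inj b _ _ (suffix-shape g p q) (suffix-shape g' p' q') e))
        (take-take a b _ le)))

  boundary-refine : ∀ a b p → a ≤ b → Boundary a p → Boundary b p
  boundary-refine a b p le (inj₁ x) = inj₁ x
  boundary-refine a b p le (inj₂ (inj₁ x)) = inj₂ (inj₁ x)
  boundary-refine a b (suc zero) le (inj₂ (inj₂ (s≤s () , y , d)))
  boundary-refine a b (suc (suc p)) le (inj₂ (inj₂ (x , y , d))) =
    inj₂ (inj₂ (x , y , λ e → d (key-refine a b _ _ le r₁ r₂ r₁' r₂' e)))
    where
    r₁ = proj₁ (sa₀₁-range (suc p) (s≤s z≤n) (≤-trans (n≤1+n _) y))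
    r₂ = proj₂ (sa₀₁-range (suc p) (s≤s z≤n) (≤-trans (n≤1+n _) y))
    r₁' = proj₁ (sa₀₁-range (suc (suc p)) (s≤s z≤n) y)
    r₂' = proj₂ (sa₀₁-range (suc (suc p)) (s≤s z≤n) y)

  -- The invariant holding at the end of every iteration h: Z^(h) satisfies the
  -- Z-invariant, and B marks exactly the level-h boundaries with values ≤ h,
  -- except for the initial marks 1 present at iteration 0.
  record Invariant (h : ℕ) (Z B : ℕ → ℕ) : Set where
    field
      z-inv            : ZInvariant h Z
      marked⇒boundary  : ∀ p → 1 ≤ p → p ≤ suc n → B p ≢ 0 → Boundary h p
      boundary⇒marked  : ∀ p → 1 ≤ p → p ≤ suc n → Boundary h p → B p ≢ 0
      mark-≤           : ∀ p → B p ≤ suc h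
      mark-top         : ∀ p → B p ≡ suc h → h ≡ 0

  module Step (h' : ℕ) (Zp Bp : ℕ → ℕ) (inv : Invariant h' Zp Bp) where
    open Invariant inv
    open ZInvariant z-inv
    open BitVector binary zeros
    open LoopState

    h : ℕ
    h = suc h'

    bw₀ bw₁ : ℕ → ℕ
    bw₀ = bwt t₀ sa₀
    bw₁ = bwt t₁ sa₁

    bwts : List ℕ
    bwts = map bw₀ (range1 n₀) ++ map bw₁ (range1 n₁)

    F-init : ℕ → ℕ
    F-init c = suc (count (λ x → x <ᵇ c) bwts)

    body : LoopState → ℕ → LoopState
    body = loopStep h Zp bw₀ bw₁

    init : LoopState
    init = ⟨ 1 , 1 , F-init , (λ _ → -[1+ 0 ]) , + 0 , (λ _ → 0) , Bp ⟩

    state : ℕ → LoopState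
    state K = foldl body init (range1 K)

    state-suc : ∀ K → state (suc K) ≡ body (state K) (suc K)
    state-suc K = foldl-range1-suc body init K

    -- Closed forms of what step k does: the symbol c it reads, the number of
    -- earlier reads of a symbol, and the position j it writes to.

    read : ℕ → ℕ
    read k = if Zp k ≡ᵇ 0 then bw₀ (suc (rank Zp 0 (k ∸ 1))) else bw₁ (suc (rank Zp 1 (k ∸ 1)))

    occ : ℕ → ℕ → ℕ
    occ c K = count (λ k → read k ≡ᵇ c) (range1 K)

    dest : ℕ → ℕ
    dest k = if 2 ≤ᵇ read k then F-init (read k) + occ (read k) (k ∸ 1) else suc (Zp k)

    counters-inv : ∀ K → K ≤ n → k₀ (state K) ≡ suc (rank Zp 0 K) × k₁ (state K) ≡ suc (rank Zp 1 K)
    counters-inv zero _ = refl , refl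
    counters-inv (suc K) le rewrite state-suc K
      with counters-inv K (≤-trans (n≤1+n K) le) | bit (suc K) (s≤s z≤n) le
    ... | e0 , e1 | inj₁ e rewrite e | e0 | e1 =
      cong suc (sym (rank-suc-eq Zp 0 K e)) ,
      cong suc (sym (rank-suc-neq Zp 1 K (λ x → 0≢1+n (trans (sym e) x))))
    ... | e0 , e1 | inj₂ e rewrite e | e0 | e1 =
      cong suc (sym (rank-suc-neq Zp 0 K (λ x → 1+n≢0 (trans (sym e) x)))) ,
      cong suc (sym (rank-suc-eq Zp 1 K e))

    dest-of : LoopState → ℕ → ℕ
    dest-of s k = if 2 ≤ᵇ read k then F s (read k) else suc (Zp k)

    id-of : LoopState → ℕ → ℤ
    id-of s k = if not (Bcur s k ≡ᵇ 0) ∧ not (Bcur s k ≡ᵇ h) then + k else ident s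

    new-of : LoopState → ℕ → Bool
    new-of s k = not (does (blockId s (read k) ℤ.≟ id-of s k))

    module BodyStep (s : LoopState) (k : ℕ)
      (e0 : k₀ s ≡ suc (rank Zp 0 (k ∸ 1))) (e1 : k₁ s ≡ suc (rank Zp 1 (k ∸ 1))) where
      F-body : ∀ c → F (body s k) c ≡
        (if 2 ≤ᵇ read k then upd (F s) (read k) (suc (F s (read k))) else F s) c
      F-body c rewrite e0 | e1 = refl

      Z-body : ∀ q → Zcur (body s k) q ≡ upd (Zcur s) (dest-of s k) (Zp k) q
      Z-body q rewrite e0 | e1 = refl

      blockId-body : ∀ c → blockId (body s k) c ≡
        (if new-of s k then upd (blockId s) (read k) (id-of s k) else blockId s) c
      blockId-body c rewrite e0 | e1 = refl

      B-body : ∀ q → Bcur (body s k) q ≡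
        (if new-of s k ∧ (Bcur s (dest-of s k) ≡ᵇ 0) then upd (Bcur s) (dest-of s k) h else Bcur s) q
      B-body q rewrite e0 | e1 = refl

    module _ (K : ℕ) (le : suc K ≤ n) where
      open BodyStep (state K) (suc K) (proj₁ (counters-inv K (≤-trans (n≤1+n K) le)))
                                      (proj₂ (counters-inv K (≤-trans (n≤1+n K) le))) public

    occ-suc : ∀ c K → occ c (suc K) ≡ occ c K + (if read (suc K) ≡ᵇ c then 1 else 0)
    occ-suc c K =
      trans (cong (count (λ k → read k ≡ᵇ c)) (range1-suc K)) (count-++ _ (range1 K) (suc K ∷ []))

    F-inv : ∀ K → K ≤ n → ∀ c → 2 ≤ c → F (state K) c ≡ F-init c + occ c K
    F-inv zero _ c _ = sym (+-identityʳ (F-init c))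
    F-inv (suc K) le c c∈Σ rewrite state-suc K =
      trans (F-body K le c) (update (F-inv K (≤-trans (n≤1+n K) le)))
      where
      update : (∀ c → 2 ≤ c → F (state K) c ≡ F-init c + occ c K) →
        (if 2 ≤ᵇ read (suc K) then upd (F (state K)) (read (suc K)) (suc (F (state K) (read (suc K))))
         else F (state K)) c ≡ F-init c + occ c (suc K)
      update ih rewrite occ-suc c K with eqbView (read (suc K)) c
      ... | eqv refl b rewrite b | le2-true c∈Σ | eqb-refl c | ih c c∈Σ =
        trans (sym (+-suc (F-init c) (occ c K))) (cong (λ z → F-init c + z) (+-comm 1 (occ c K)))
      ... | neqv ne b rewrite b | +-identityʳ (occ c K) with 2 ≤ᵇ read (suc K)
      ...   | true rewrite eqb-neq {c} {read (suc K)} (λ x → ne (sym x)) = ih c c∈Σ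
      ...   | false = ih c c∈Σ

    dest-inv : ∀ K → K ≤ n → dest-of (state K) (suc K) ≡ dest (suc K)
    dest-inv K le with le2-view (read (suc K))
    ... | inj₁ (e , p) rewrite e = F-inv K le (read (suc K)) p
    ... | inj₂ (e , p) rewrite e = refl

    -- Reading from one side δ ∈ {0,1}: a step k with Zp k = δ reads the bwt
    -- symbol in front of the rank-th suffix of t_δ, i.e. the symbol at the cyclic
    -- predecessor of its starting position.
    module ReadSide (a : List ℕ) (δ : ℕ) (free-a : DollarFree a) (δ<2 : δ < 2) (sa : ℕ → ℕ)
      (is : IsSuffixArray (a ++ δ ∷ []) sa)
      (read-side : ∀ k → 1 ≤ k → k ≤ n → Zp k ≡ δ → read k ≡ bwt (a ++ δ ∷ []) sa (rank Zp δ k))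
      (side-count : rank Zp δ n ≡ length (a ++ δ ∷ [])) where
      open Terminated a δ free-a δ<2 public
      open SuffixArrayFacts t sa is public

      rank-range : ∀ k → 1 ≤ k → k ≤ n → Zp k ≡ δ → 1 ≤ rank Zp δ k × rank Zp δ k ≤ length t
      rank-range k p q e = rank-pos Zp δ p e , subst (rank Zp δ k ≤_) side-count (rank-mono Zp δ q)

      suffix-range : ∀ k → 1 ≤ k → k ≤ n → Zp k ≡ δ →
        1 ≤ sa (rank Zp δ k) × sa (rank Zp δ k) ≤ length t
      suffix-range k p q e = let (u , v) = rank-range k p q e in sa-range _ u v

      read-pred : ∀ k → 1 ≤ k → k ≤ n → Zp k ≡ δ → read k ≡ at t (cyc-pred (sa (rank Zp δ k)))
      read-pred k p q e = trans (read-side k p q e) (bwt-cyc-pred sa (rank Zp δ k))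

      read-dollar : ∀ k → 1 ≤ k → k ≤ n → Zp k ≡ δ → read k < 2 → read k ≡ δ × sa (rank Zp δ k) ≡ 1
      read-dollar k p q e s =
        let (u , v) = suffix-range k p q e
            (w , z) = pred-dollar _ u v (subst (_< 2) (read-pred k p q e) s)
        in trans (read-pred k p q e) (trans (cong (at t) z) at-last) , w

      read-dollar-once : ∀ k k' → 1 ≤ k → k ≤ n → 1 ≤ k' → k' ≤ n → Zp k ≡ δ → Zp k' ≡ δ →
        read k < 2 → read k' < 2 → k ≡ k'
      read-dollar-once k k' p q p' q' e e' s s' =
        let (u , v) = rank-range k p q e ; (u' , v') = rank-range k' p' q' e' in
        rank-inj Zp δ e e' (sa-inj _ _ u v u' v'
          (trans (proj₂ (read-dollar k p q e s)) (sym (proj₂ (read-dollar k' p' q' e' s')))))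

    read-side₀ : ∀ k → 1 ≤ k → k ≤ n → Zp k ≡ 0 → read k ≡ bwt t₀ sa₀ (rank Zp 0 k)
    read-side₀ (suc K) _ _ e rewrite e | rank-suc-eq Zp 0 K e = refl

    read-side₁ : ∀ k → 1 ≤ k → k ≤ n → Zp k ≡ 1 → read k ≡ bwt t₁ sa₁ (rank Zp 1 k)
    read-side₁ (suc K) _ _ e rewrite e | rank-suc-eq Zp 1 K e = refl

    module R₀ = ReadSide u₀ 0 free₀ (s≤s z≤n) sa₀ isa₀ read-side₀ zeros
    module R₁ = ReadSide u₁ 1 free₁ (s≤s (s≤s z≤n)) sa₁ isa₁ read-side₁ ones

    dollar-read : ∀ k → 1 ≤ k → k ≤ n → read k < 2 → read k ≡ Zp k
    dollar-read k p q s with bit k p q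
    ... | inj₁ e = trans (proj₁ (R₀.read-dollar k p q e s)) (sym e)
    ... | inj₂ e = trans (proj₁ (R₁.read-dollar k p q e s)) (sym e)

    dollar-once : ∀ k k' → 1 ≤ k → k ≤ n → 1 ≤ k' → k' ≤ n → read k ≡ read k' → read k < 2 → k ≡ k'
    dollar-once k k' p q p' q' e s with bit k p q | bit k' p' q'
    ... | inj₁ z | inj₁ z' = R₀.read-dollar-once k k' p q p' q' z z' s (subst (_< 2) e s)
    ... | inj₂ z | inj₂ z' = R₁.read-dollar-once k k' p q p' q' z z' s (subst (_< 2) e s)
    ... | inj₁ z | inj₂ z' = ⊥-elim (0≢1+n (trans (sym z) (trans (sym (dollar-read k p q s))
                               (trans e (trans (dollar-read k' p' q' (subst (_< 2) e s)) z')))))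
    ... | inj₂ z | inj₁ z' = ⊥-elim (0≢1+n (trans (sym z') (trans (sym (dollar-read k' p' q' (subst (_< 2) e s)))
                               (trans (sym e) (trans (dollar-read k p q s) z)))))

    count-merge : ∀ (P : ℕ → Bool) K → K ≤ n →
      count (λ k → P (read k)) (range1 K) ≡
      count P (map bw₀ (range1 (rank Zp 0 K))) + count P (map bw₁ (range1 (rank Zp 1 K)))
    count-merge P zero _ = refl
    count-merge P (suc K) le with bit (suc K) (s≤s z≤n) le
    ... | inj₁ e = begin
        count (λ k → P (read k)) (range1 (suc K))
          ≡⟨ last-read ⟩
        (A + B) + X
          ≡⟨ +-assoc A B X ⟩
        A + (B + X)
          ≡⟨ cong (λ z → A + z) (+-comm B X) ⟩
        A + (X + B)
          ≡⟨ sym (+-assoc A X B) ⟩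
        (A + X) + B
          ≡⟨ cong₂ _+_ (sym (count-map-snoc P bw₀ (rank Zp 0 K)))
                       (cong (λ r → count P (map bw₁ (range1 r))) (sym (rank-suc-neq Zp 1 K (λ x → 0≢1+n (trans (sym e) x))))) ⟩
        count P (map bw₀ (range1 (suc (rank Zp 0 K)))) + count P (map bw₁ (range1 (rank Zp 1 (suc K))))
          ≡⟨ cong (λ r → count P (map bw₀ (range1 r)) + count P (map bw₁ (range1 (rank Zp 1 (suc K)))))
                  (sym (rank-suc-eq Zp 0 K e)) ⟩
        count P (map bw₀ (range1 (rank Zp 0 (suc K)))) + count P (map bw₁ (range1 (rank Zp 1 (suc K)))) ∎
      where
      open ≡-Reasoning
      A = count P (map bw₀ (range1 (rank Zp 0 K)))
      B = count P (map bw₁ (range1 (rank Zp 1 K)))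
      X = count P (bw₀ (suc (rank Zp 0 K)) ∷ [])
      last-read : count (λ k → P (read k)) (range1 (suc K)) ≡ (A + B) + X
      last-read = trans (cong (count (λ k → P (read k))) (range1-suc K)) (trans (count-++ _ (range1 K) (suc K ∷ []))
        (cong₂ _+_ (count-merge P K (≤-trans (n≤1+n K) le))
                   (cong (λ z → count P (z ∷ [])) (trans (read-side₀ (suc K) (s≤s z≤n) le e) (cong bw₀ (rank-suc-eq Zp 0 K e))))))
    ... | inj₂ e = begin
        count (λ k → P (read k)) (range1 (suc K))
          ≡⟨ last-read ⟩
        (A + B) + X
          ≡⟨ +-assoc A B X ⟩
        A + (B + X)
          ≡⟨ cong₂ _+_ (cong (λ r → count P (map bw₀ (range1 r))) (sym (rank-suc-neq Zp 0 K (λ x → 1+n≢0 (trans (sym e) x)))))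
                       (sym (count-map-snoc P bw₁ (rank Zp 1 K))) ⟩
        count P (map bw₀ (range1 (rank Zp 0 (suc K)))) + count P (map bw₁ (range1 (suc (rank Zp 1 K))))
          ≡⟨ cong (λ r → count P (map bw₀ (range1 (rank Zp 0 (suc K)))) + count P (map bw₁ (range1 r)))
                  (sym (rank-suc-eq Zp 1 K e)) ⟩
        count P (map bw₀ (range1 (rank Zp 0 (suc K)))) + count P (map bw₁ (range1 (rank Zp 1 (suc K)))) ∎
      where
      open ≡-Reasoning
      A = count P (map bw₀ (range1 (rank Zp 0 K)))
      B = count P (map bw₁ (range1 (rank Zp 1 K)))
      X = count P (bw₁ (suc (rank Zp 1 K)) ∷ [])
      last-read : count (λ k → P (read k)) (range1 (suc K)) ≡ (A + B) + X
      last-read = trans (cong (count (λ k → P (read k))) (range1-suc K)) (trans (count-++ _ (range1 K) (suc K ∷ []))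
        (cong₂ _+_ (count-merge P K (≤-trans (n≤1+n K) le))
                   (cong (λ z → count P (z ∷ [])) (trans (read-side₁ (suc K) (s≤s z≤n) le e) (cong bw₁ (rank-suc-eq Zp 1 K e))))))

    total-occ : ℕ → ℕ
    total-occ c = count (λ x → x ≡ᵇ c) bwts

    length-bwts : length bwts ≡ n
    length-bwts = trans (length-++ (map bw₀ (range1 n₀)))
      (cong₂ _+_ (trans (length-map bw₀ (range1 n₀)) (length-range1 n₀))
                 (trans (length-map bw₁ (range1 n₁)) (length-range1 n₁)))

    bwts-count : ∀ P → count P bwts ≡ count P (map bw₀ (range1 n₀)) + count P (map bw₁ (range1 n₁))
    bwts-count P = count-++ P (map bw₀ (range1 n₀)) _

    occ-total : ∀ c → occ c n ≡ total-occ c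
    occ-total c = trans (count-merge (λ x → x ≡ᵇ c) n ≤-refl)
      (trans (cong₂ (λ r r' → count (λ x → x ≡ᵇ c) (map bw₀ (range1 r)) + count (λ x → x ≡ᵇ c) (map bw₁ (range1 r')))
                    zeros ones)
        (sym (bwts-count _)))

    -- The slots [F-init c, F-init c + total-occ c) of distinct symbols c are
    -- disjoint, increasing in c, lie in [1, n], and come after the two slots
    -- 1, 2 reserved for $₀, $₁.

    F-init-gap : ∀ {c c'} → c < c' → F-init c + total-occ c ≤ F-init c'
    F-init-gap {c} {c'} lt = s≤s (≤-trans (≤-reflexive (count-split c bwts)) (count-lt-mono lt bwts))

    F-init-top : ∀ c → F-init c + total-occ c ≤ suc n
    F-init-top c =
      s≤s (≤-trans (≤-reflexive (count-split c bwts)) (≤-trans (count-≤ _ bwts) (≤-reflexive length-bwts)))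

    -- each bwt contains its terminator (in front of the whole string)
    dollars-in-bwts : 2 ≤ count (λ x → x <ᵇ 2) bwts
    dollars-in-bwts = ≤-trans (+-mono-≤ dollar₀ dollar₁) (≤-reflexive (sym (bwts-count _)))
      where
      dollar₀ : 1 ≤ count (λ x → x <ᵇ 2) (map bw₀ (range1 n₀))
      dollar₀ = let (r , p , q , e) = R₀.sa-onto 1 ≤-refl R₀.len≥1 in
        count-hit _ bw₀ n₀ r p q (cong (_<ᵇ 2) (R₀.bwt-first sa₀ r e))
      dollar₁ : 1 ≤ count (λ x → x <ᵇ 2) (map bw₁ (range1 n₁))
      dollar₁ = let (r , p , q , e) = R₁.sa-onto 1 ≤-refl R₁.len≥1 in
        count-hit _ bw₁ n₁ r p q (cong (_<ᵇ 2) (R₁.bwt-first sa₁ r e))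

    F-init-bot : ∀ c → 2 ≤ c → 3 ≤ F-init c
    F-init-bot c p = s≤s (≤-trans dollars-in-bwts (count-lt-mono p bwts))

    -- dest is a bijection of [1, n]: Σ-symbols are sent into the slot of
    -- their symbol in order of reading, $_δ to position δ+1

    dest-sigma : ∀ k → 2 ≤ read k → dest k ≡ F-init (read k) + occ (read k) (k ∸ 1)
    dest-sigma k p rewrite le2-true p = refl

    dest-dollar : ∀ k → read k < 2 → dest k ≡ suc (Zp k)
    dest-dollar k p rewrite le2-false p = refl

    dest≥3 : ∀ k → 2 ≤ read k → 3 ≤ dest k
    dest≥3 k b = ≤-trans (F-init-bot (read k) b) (≤-trans (m≤m+n _ _) (≤-reflexive (sym (dest-sigma k b))))

    occ-at : ∀ k → 1 ≤ k → occ (read k) k ≡ suc (occ (read k) (k ∸ 1))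
    occ-at (suc K) _ = rank-suc-eq read (read (suc K)) K refl

    dest-below : ∀ k → 1 ≤ k → k ≤ n → 2 ≤ read k → dest k < F-init (read k) + total-occ (read k)
    dest-below k p q b rewrite dest-sigma k b =
      +-monoʳ-< (F-init (read k)) (≤-trans (≤-reflexive (sym (occ-at k p)))
        (≤-trans (rank-mono read (read k) q) (≤-reflexive (occ-total (read k)))))

    dest-range : ∀ k → 1 ≤ k → k ≤ n → 1 ≤ dest k × dest k ≤ n
    dest-range k p q with le2-view (read k)
    ... | inj₁ (e , b) = ≤-trans (s≤s z≤n) (≤-reflexive (sym (dest-sigma k b))) ,
                         ≤-pred (≤-trans (dest-below k p q b) (F-init-top (read k)))
    ... | inj₂ (e , b) rewrite dest-dollar k b = s≤s z≤n , ≤-trans (s≤s (binary k p q)) n≥2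

    dest-lt-symbol : ∀ k k' → 1 ≤ k → k ≤ n → 1 ≤ k' → k' ≤ n → read k < read k' → dest k < dest k'
    dest-lt-symbol k k' p q p' q' lt with le2-view (read k') | le2-view (read k)
    ... | inj₁ (_ , b') | inj₁ (_ , b) =
      ≤-trans (dest-below k p q b) (≤-trans (F-init-gap lt) (≤-trans (m≤m+n _ _) (≤-reflexive (sym (dest-sigma k' b')))))
    ... | inj₁ (_ , b') | inj₂ (_ , s) rewrite dest-dollar k s | dest-sigma k' b' =
      ≤-trans (s≤s (s≤s (binary k p q))) (≤-trans (F-init-bot (read k') b') (m≤m+n _ _))
    ... | inj₂ (_ , s') | inj₂ (_ , s) rewrite dest-dollar k s | dest-dollar k' s' =
      s≤s (subst₂ _<_ (dollar-read k p q s) (dollar-read k' p' q' s') lt)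
    ... | inj₂ (_ , s') | inj₁ (_ , b) = ⊥-elim (<⇒≱ (≤-trans lt (≤-pred s')) (≤-trans (s≤s z≤n) b))

    dest-lt-step : ∀ k k' → 1 ≤ k → k' ≤ n → read k ≡ read k' → 2 ≤ read k → k < k' → dest k < dest k'
    dest-lt-step k (suc k'') p q e b (s≤s lt)
      rewrite dest-sigma k b | dest-sigma (suc k'') (subst (2 ≤_) e b) | sym e =
      +-monoʳ-< (F-init (read k)) (≤-trans (≤-reflexive (sym (occ-at k p))) (rank-mono read (read k) lt))

    dest-inj : Injective n dest
    dest-inj k k' p q p' q' e with <-cmp (read k) (read k')
    ... | tri< a _ _ = ⊥-elim (<⇒≢ (dest-lt-symbol k k' p q p' q' a) e)
    ... | tri> _ _ c = ⊥-elim (<⇒≢ (dest-lt-symbol k' k p' q' p q c) (sym e))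
    ... | tri≈ _ ce _ with le2-view (read k)
    ...   | inj₂ (_ , s) = dollar-once k k' p q p' q' ce s
    ...   | inj₁ (_ , b) with <-cmp k k'
    ...     | tri< a _ _ = ⊥-elim (<⇒≢ (dest-lt-step k k' p q' ce b a) e)
    ...     | tri≈ _ x _ = x
    ...     | tri> _ _ c = ⊥-elim (<⇒≢ (dest-lt-step k' k p' q (sym ce) (subst (2 ≤_) ce b) c) (sym e))

    dest-onto : ∀ p → 1 ≤ p → p ≤ n → Σ ℕ λ k → 1 ≤ k × k ≤ n × dest k ≡ p
    dest-onto = surjective n dest dest-range dest-inj

    Z-written : ∀ K → K ≤ n → ∀ k → 1 ≤ k → k ≤ K → Zcur (state K) (dest k) ≡ Zp k
    Z-written zero _ (suc k) p ()
    Z-written (suc K) le k p q =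
      trans (cong (λ s → Zcur s (dest k)) (state-suc K))
        (trans (Z-body K le (dest k))
          (trans (cong (λ j → upd (Zcur (state K)) j (Zp (suc K)) (dest k)) (dest-inv K (≤-trans (n≤1+n K) le)))
            (written (m≤n⇒m<n∨m≡n q))))
      where
      written : k < suc K ⊎ k ≡ suc K → upd (Zcur (state K)) (dest (suc K)) (Zp (suc K)) (dest k) ≡ Zp k
      written (inj₂ refl) = upd-eq (Zcur (state K)) (dest k) (Zp k)
      written (inj₁ (s≤s q')) =
        trans (upd-neq (Zcur (state K)) (dest (suc K)) (Zp (suc K)) (dest k)
                (λ e → <⇒≢ (s≤s q') (dest-inj k (suc K) p (≤-trans q le) (s≤s z≤n) le e)))
              (Z-written K (≤-trans (n≤1+n K) le) k p q')

    -- Step (1) resets id at k when B[k] is a mark from an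
    -- earlier iteration, i.e. when k starts a block of Z^(h') (the mark value h
    -- can only have been written in this iteration).  idAt K is the current id
    -- after step K, lastId c K the id recorded for c at its last read, and fresh k
    -- is the test of step (5).

    starts : ℕ → Bool
    starts q = not (Bp q ≡ᵇ 0) ∧ not (Bp q ≡ᵇ h)

    idAt : ℕ → ℤ
    idAt zero = + 0
    idAt (suc K) = if starts (suc K) then + suc K else idAt K

    lastId : ℕ → ℕ → ℤ
    lastId c zero = -[1+ 0 ]
    lastId c (suc K) = if read (suc K) ≡ᵇ c then idAt (suc K) else lastId c K

    fresh : ℕ → Bool
    fresh k = not (does (lastId (read k) (k ∸ 1) ℤ.≟ idAt k))

    OldOrNew : ℕ → ℕ → Set
    OldOrNew x q = x ≡ Bp q ⊎ (Bp q ≡ 0 × x ≡ h)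

    starts-test : ∀ x q → OldOrNew x q → (not (x ≡ᵇ 0) ∧ not (x ≡ᵇ h)) ≡ starts q
    starts-test x q (inj₁ refl) = refl
    starts-test x q (inj₂ (e , refl)) rewrite e | eqb-refl h = refl

    B-values : ∀ K → K ≤ n → ∀ p → OldOrNew (Bcur (state K) p) p
    B-values zero _ p = inj₁ refl
    B-values (suc K) le p rewrite state-suc K | B-body K le p
      with new-of (state K) (suc K) | eqbView (Bcur (state K) (dest-of (state K) (suc K))) 0
         | B-values K (≤-trans (n≤1+n K) le) p
    ... | false | _ | ih = ih
    ... | true | neqv _ b | ih rewrite b = ih
    ... | true | eqv z b | ih rewrite b with eqbView p (dest-of (state K) (suc K))
    ...   | eqv refl b' rewrite b' = inj₂ (was-zero ih z , refl)
      where
      was-zero : OldOrNew (Bcur (state K) p) p → Bcur (state K) p ≡ 0 → Bp p ≡ 0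
      was-zero (inj₁ e) z = trans (sym e) z
      was-zero (inj₂ (e , _)) _ = e
    ...   | neqv _ b' rewrite b' = ih

    id-of-inv : ∀ K → K ≤ n → ident (state K) ≡ idAt K → suc K ≤ n → id-of (state K) (suc K) ≡ idAt (suc K)
    id-of-inv K _ ih le'
      rewrite starts-test (Bcur (state K) (suc K)) (suc K) (B-values K (≤-trans (n≤1+n K) le') (suc K)) | ih = refl

    id-inv : ∀ K → K ≤ n → ident (state K) ≡ idAt K
    id-inv zero _ = refl
    id-inv (suc K) le rewrite state-suc K =
      id-of-inv K (≤-trans (n≤1+n K) le) (id-inv K (≤-trans (n≤1+n K) le)) le

    blockId-update : ∀ (f : ℕ → ℤ) (C c : ℕ) (v : ℤ) →
      (if not (does (f C ℤ.≟ v)) then upd f C v else f) c ≡ (if C ≡ᵇ c then v else f c)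
    blockId-update f C c v with eqbView C c
    ... | eqv refl b rewrite b with f C ℤ.≟ v
    ...   | yes x = x
    ...   | no _ = upd-eq f C v
    blockId-update f C c v | neqv ne b rewrite b with f C ℤ.≟ v
    ...   | yes x = refl
    ...   | no _ = upd-neq f C v c (λ x → ne (sym x))

    blockId-inv : ∀ K → K ≤ n → ∀ c → blockId (state K) c ≡ lastId c K
    blockId-inv zero _ c = refl
    blockId-inv (suc K) le c = begin
        blockId (state (suc K)) c
          ≡⟨ cong (λ s → blockId s c) (state-suc K) ⟩
        blockId (body (state K) (suc K)) c
          ≡⟨ blockId-body K le c ⟩
        (if new-of (state K) (suc K) then upd (blockId (state K)) (read (suc K)) (id-of (state K) (suc K))
         else blockId (state K)) c
          ≡⟨ blockId-update (blockId (state K)) (read (suc K)) c (id-of (state K) (suc K)) ⟩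
        (if read (suc K) ≡ᵇ c then id-of (state K) (suc K) else blockId (state K) c)
          ≡⟨ cong₂ (λ x y → if read (suc K) ≡ᵇ c then x else y)
                   (id-of-inv K le' (id-inv K le') le) (blockId-inv K le' c) ⟩
        lastId c (suc K) ∎
      where
      open ≡-Reasoning
      le' = ≤-trans (n≤1+n K) le

    new-inv : ∀ K → suc K ≤ n → new-of (state K) (suc K) ≡ fresh (suc K)
    new-inv K le = cong₂ (λ x y → not (does (x ℤ.≟ y)))
      (blockId-inv K le' (read (suc K))) (id-of-inv K le' (id-inv K le') le)
      where le' = ≤-trans (n≤1+n K) le

    mark : (ℕ → ℕ) → Bool → ℕ → ℕ → ℕ
    mark f new j = if new ∧ (f j ≡ᵇ 0) then upd f j h else f

    mark-keeps : ∀ f new j q → f q ≢ 0 → mark f new j q ≢ 0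
    mark-keeps f new j q ne with new | eqbView (f j) 0
    ... | false | _ = ne
    ... | true | neqv _ b rewrite b = ne
    ... | true | eqv z b rewrite b with eqbView q j
    ...   | eqv refl b' = ⊥-elim (ne z)
    ...   | neqv _ b' rewrite b' = ne

    mark-sets : ∀ f new j → new ≡ true → mark f new j j ≢ 0
    mark-sets f new j refl with eqbView (f j) 0
    ... | neqv ne b rewrite b = ne
    ... | eqv z b rewrite b | eqb-refl j = λ ()

    mark-source : ∀ f new j q → mark f new j q ≢ 0 → f q ≢ 0 ⊎ (q ≡ j × new ≡ true)
    mark-source f new j q ne with new | eqbView (f j) 0
    ... | false | _ = inj₁ ne
    ... | true | neqv _ b rewrite b = inj₁ ne
    ... | true | eqv z b rewrite b with eqbView q j
    ...   | eqv e b' = inj₂ (e , refl)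
    ...   | neqv _ b' rewrite b' = inj₁ ne

    Bafter : ℕ → ℕ → ℕ
    Bafter K = Bcur (state K)

    Bafter-suc : ∀ K → suc K ≤ n → ∀ q → Bafter (suc K) q ≡ mark (Bafter K) (fresh (suc K)) (dest (suc K)) q
    Bafter-suc K le q = trans (cong (λ s → Bcur s q) (state-suc K)) (trans (B-body K le q)
      (cong₂ (λ new j → mark (Bafter K) new j q) (new-inv K le) (dest-inv K (≤-trans (n≤1+n K) le))))

    marks-kept : ∀ K → K ≤ n → ∀ q → Bp q ≢ 0 → Bafter K q ≢ 0
    marks-kept zero _ q ne = ne
    marks-kept (suc K) le q ne e =
      mark-keeps (Bafter K) (fresh (suc K)) (dest (suc K)) q (marks-kept K (≤-trans (n≤1+n K) le) q ne)
        (trans (sym (Bafter-suc K le q)) e)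

    marks-set : ∀ K → K ≤ n → ∀ k → 1 ≤ k → k ≤ K → fresh k ≡ true → Bafter K (dest k) ≢ 0
    marks-set zero _ (suc k) p () new
    marks-set (suc K) le k p q new e with m≤n⇒m<n∨m≡n q
    ... | inj₂ refl = mark-sets (Bafter K) (fresh k) (dest k) new (trans (sym (Bafter-suc K le (dest k))) e)
    ... | inj₁ (s≤s q') =
      mark-keeps (Bafter K) (fresh (suc K)) (dest (suc K)) (dest k) (marks-set K (≤-trans (n≤1+n K) le) k p q' new)
        (trans (sym (Bafter-suc K le (dest k))) e)

    marks-sourced : ∀ K → K ≤ n → ∀ q → Bafter K q ≢ 0 →
      Bp q ≢ 0 ⊎ Σ ℕ λ k → 1 ≤ k × k ≤ K × dest k ≡ q × fresh k ≡ true
    marks-sourced zero _ q ne = inj₁ ne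
    marks-sourced (suc K) le q ne
      with mark-source (Bafter K) (fresh (suc K)) (dest (suc K)) q (λ e → ne (trans (Bafter-suc K le q) e))
    ... | inj₂ (e , new) = inj₂ (suc K , s≤s z≤n , ≤-refl , sym e , new)
    ... | inj₁ ne' with marks-sourced K (≤-trans (n≤1+n K) le) q ne'
    ...   | inj₁ x = inj₁ x
    ...   | inj₂ (k , a , b , c , d) = inj₂ (k , a , m≤n⇒m≤1+n b , c , d)

    Znew : ℕ → ℕ
    Znew q = Zcur (state n) q

    Znew-dest : ∀ k → 1 ≤ k → k ≤ n → Znew (dest k) ≡ Zp k
    Znew-dest k p q = Z-written n ≤-refl k p q

    Znew-binary : Binary Znew
    Znew-binary p a b = let (k , x , y , e) = dest-onto p a b in
      subst (λ z → Znew z ≤ 1) e (subst (_≤ 1) (sym (Znew-dest k x y)) (binary k x y))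

    -- The suffix of t_δ associated with position dest k of
    -- Z^(h) is the cyclic predecessor of the one associated with position k of
    -- Z^(h'): reading a symbol prepends it to the context.  The proof goes
    -- through ψ s = rank in Z^(h) of the destination of the step that reads the
    -- symbol in front of the s-th suffix; ψ is strictly increasing, which first
    -- forces Z^(h) to have the right number of δ's and then ψ = id.
    module LFSide (a : List ℕ) (δ : ℕ) (free-a : DollarFree a) (δ<2 : δ < 2) (sa : ℕ → ℕ)
      (is : IsSuffixArray (a ++ δ ∷ []) sa)
      (read-side : ∀ k → 1 ≤ k → k ≤ n → Zp k ≡ δ → read k ≡ bwt (a ++ δ ∷ []) sa (rank Zp δ k))
      (side-count : rank Zp δ n ≡ length (a ++ δ ∷ [])) where
      open ReadSide a δ free-a δ<2 sa is read-side side-count public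

      readsAt : ℕ → ℕ → Bool
      readsAt s k = (Zp k ≡ᵇ δ) ∧ (sa (rank Zp δ k) ≡ᵇ cyc-succ (sa s))

      stepOf : ℕ → ℕ
      stepOf s = findLast (readsAt s) n

      stepOf-spec : ∀ s → 1 ≤ s → s ≤ length t →
        1 ≤ stepOf s × stepOf s ≤ n × Zp (stepOf s) ≡ δ × sa (rank Zp δ (stepOf s)) ≡ cyc-succ (sa s)
      stepOf-spec s p q =
        let (x1 , x2) = sa-range s p q
            (y1 , y2) = succ-range (sa s) x1 x2
            (r , r1 , r2 , re) = sa-onto (cyc-succ (sa s)) y1 y2
            (k , k1 , k2 , kz , kr) = rank-hit Zp δ n r r1 (subst (r ≤_) (sym side-count) r2)
            hit : readsAt s k ≡ true
            hit = ∧-intro (eqb-true kz) (eqb-true (trans (cong sa kr) re))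
            (f1 , f2 , f3) = findLast-spec (readsAt s) n k k1 k2 hit
        in f2 , f3 , eqb-sound (∧-left f1) , eqb-sound (∧-right {Zp (stepOf s) ≡ᵇ δ} f1)

      read-stepOf : ∀ s → 1 ≤ s → s ≤ length t → read (stepOf s) ≡ at t (sa s)
      read-stepOf s p q = let (k1 , k2 , kz , ky) = stepOf-spec s p q ; (x1 , x2) = sa-range s p q in
        trans (read-pred (stepOf s) k1 k2 kz)
          (trans (cong (λ z → at t (cyc-pred z)) ky) (cong (at t) (pred-succ (sa s) x1 x2)))

      ψ : ℕ → ℕ
      ψ s = rank Znew δ (dest (stepOf s))

      -- consecutive suffixes are read in an order that dest makes increasing
      ψ-inc : StrictlyIncreasing (length t) ψ
      ψ-inc s p q = rank-lt Znew δ dest-lt (trans (Znew-dest k' k1' k2') kz')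
        where
        k = stepOf s
        k' = stepOf (suc s)
        spec = stepOf-spec s p (≤-trans (n≤1+n s) q)
        spec' = stepOf-spec (suc s) (s≤s z≤n) q
        k1 = proj₁ spec ; k2 = proj₁ (proj₂ spec) ; kz = proj₁ (proj₂ (proj₂ spec)) ; ky = proj₂ (proj₂ (proj₂ spec))
        k1' = proj₁ spec' ; k2' = proj₁ (proj₂ spec') ; kz' = proj₁ (proj₂ (proj₂ spec')) ; ky' = proj₂ (proj₂ (proj₂ spec'))
        x = sa s
        x' = sa (suc s)
        xr = sa-range s p (≤-trans (n≤1+n s) q)
        xr' = sa-range (suc s) (s≤s z≤n) q
        suffix-lt : suffix t x ≺ suffix t x'
        suffix-lt = sa-lt s (suc s) p (n<1+n s) q
        ce : read k ≡ at t x
        ce = read-stepOf s p (≤-trans (n≤1+n s) q)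
        ce' : read k' ≡ at t x'
        ce' = read-stepOf (suc s) (s≤s z≤n) q
        head-le : at t x ≤ at t x'
        head-le = ≺-head (subst₂ _≺_ (suf-cons x (proj₁ xr) (proj₂ xr)) (suf-cons x' (proj₁ xr') (proj₂ xr')) suffix-lt)
        -- equal Σ heads: the tails are ordered, hence so are the reading steps
        step-lt : read k ≡ read k' → 2 ≤ read k → k < k'
        step-lt e big = rank-reflects-< Zp δ (sa-reflects-< _ _ (proj₁ rr) (proj₂ rr) (proj₁ rr') (proj₂ rr')
                          (subst₂ (λ u v → suffix t u ≺ suffix t v) (sym ky) (sym ky') tails-lt))
          where
          rr = rank-range k k1 k2 kz
          rr' = rank-range k' k1' k2' kz'
          tails-lt : suffix t (cyc-succ x) ≺ suffix t (cyc-succ x')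
          tails-lt = ≺-tail (subst₂ _≺_ (suf-succ x (proj₁ xr) (proj₂ xr) (subst (2 ≤_) ce big))
            (trans (suf-succ x' (proj₁ xr') (proj₂ xr') (subst (2 ≤_) (trans e ce') big))
                   (cong (λ z → z ∷ suffix t (cyc-succ x')) (trans (sym ce') (trans (sym e) ce)))) suffix-lt)
        -- equal $ heads would make the two suffixes equal
        same-start : k ≡ k' → x ≡ x'
        same-start kk = trans (sym (pred-succ x (proj₁ xr) (proj₂ xr)))
          (trans (cong cyc-pred (trans (sym ky) (trans (cong (λ z → sa (rank Zp δ z)) kk) ky')))
                 (pred-succ x' (proj₁ xr') (proj₂ xr')))
        dest-lt : dest k < dest k'
        dest-lt with <-cmp (read k) (read k')
        ... | tri< a' _ _ = dest-lt-symbol k k' k1 k2 k1' k2' a'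
        ... | tri> _ _ c' = ⊥-elim (<⇒≱ (subst₂ _<_ ce' ce c') head-le)
        ... | tri≈ _ e _ with le2-view (read k)
        ...   | inj₁ (_ , big) = dest-lt-step k k' k1 k2' e big (step-lt e big)
        ...   | inj₂ (_ , sm) = ⊥-elim (≺-irrefl (subst (λ z → suffix t z ≺ suffix t x')
                                    (same-start (dollar-once k k' k1 k2 k1' k2' e sm)) suffix-lt))

      ψ-range : ∀ s → 1 ≤ s → s ≤ length t → 1 ≤ ψ s × ψ s ≤ rank Znew δ n
      ψ-range s p q = let (k1 , k2 , kz , _) = stepOf-spec s p q ; (j1 , j2) = dest-range (stepOf s) k1 k2 in
        rank-pos Znew δ j1 (trans (Znew-dest (stepOf s) k1 k2) kz) , rank-mono Znew δ j2

      side-size : length t ≤ rank Znew δ n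
      side-size = incr-size (length t) (rank Znew δ n) ψ ψ-inc ψ-range

      module _ (count-exact : rank Znew δ n ≡ length t)
        (ctx-side : ∀ g Z p → Z p ≡ δ → ctx g Z p ≡ take g (suffix t (sa (rank Z δ p)))) where
        ψ-id : ∀ s → 1 ≤ s → s ≤ length t → ψ s ≡ s
        ψ-id = incr-identity (length t) ψ ψ-inc
          (λ s p q → let (u , v) = ψ-range s p q in u , subst (ψ s ≤_) count-exact v)

        lf-origin : ∀ k → 1 ≤ k → k ≤ n → Zp k ≡ δ → sa (rank Znew δ (dest k)) ≡ cyc-pred (sa (rank Zp δ k))
        lf-origin k p q z =
          let (y1 , y2) = suffix-range k p q z
              (x1 , x2) = pred-range _ y1 y2
              (s , s1 , s2 , se) = sa-onto (cyc-pred (sa (rank Zp δ k))) x1 x2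
              (k1 , k2 , kz , ky) = stepOf-spec s s1 s2
              r0 = rank-range k p q z
              r1 = rank-range (stepOf s) k1 k2 kz
              kk : stepOf s ≡ k
              kk = rank-inj Zp δ kz z (sa-inj _ _ (proj₁ r1) (proj₂ r1) (proj₁ r0) (proj₂ r0)
                     (trans ky (trans (cong cyc-succ se) (succ-pred _ y1 y2))))
          in trans (cong (λ z' → sa (rank Znew δ (dest z'))) (sym kk)) (trans (cong sa (ψ-id s s1 s2)) se)

        ctx-dest-sigma : ∀ k → 1 ≤ k → k ≤ n → Zp k ≡ δ → 2 ≤ read k → ctx h Znew (dest k) ≡ read k ∷ ctx h' Zp k
        ctx-dest-sigma k p q z big =
          let (y1 , y2) = suffix-range k p q z in
          trans (ctx-side h Znew (dest k) (trans (Znew-dest k p q) z))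
            (trans (cong (λ w → take h (suffix t w)) (lf-origin k p q z))
              (trans (cong (take h) (suf-pred _ y1 y2 (subst (2 ≤_) (read-pred k p q z) big)))
                (cong₂ _∷_ (sym (read-pred k p q z)) (sym (ctx-side h' Zp k z)))))

        ctx-dest-dollar : ∀ k → 1 ≤ k → k ≤ n → Zp k ≡ δ → read k < 2 → ctx h Znew (dest k) ≡ read k ∷ []
        ctx-dest-dollar k p q z sm =
          let (y1 , y2) = suffix-range k p q z
              (w1 , w2) = pred-dollar _ y1 y2 (subst (_< 2) (read-pred k p q z) sm)
          in trans (ctx-side h Znew (dest k) (trans (Znew-dest k p q) z))
              (trans (cong (λ w → take h (suffix t w)) (trans (lf-origin k p q z) w2))
                (trans (cong (take h) suf-last)
                  (cong₂ _∷_ (sym (proj₁ (read-dollar k p q z sm))) (take-[] h'))))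

    ctx-side₀ : ∀ g Z p → Z p ≡ 0 → ctx g Z p ≡ take g (suffix t₀ (sa₀ (rank Z 0 p)))
    ctx-side₀ g Z p e rewrite e = refl

    ctx-side₁ : ∀ g Z p → Z p ≡ 1 → ctx g Z p ≡ take g (suffix t₁ (sa₁ (rank Z 1 p)))
    ctx-side₁ g Z p e rewrite e = refl

    module LF₀ = LFSide u₀ 0 free₀ (s≤s z≤n) sa₀ isa₀ read-side₀ zeros
    module LF₁ = LFSide u₁ 1 free₁ (s≤s (s≤s z≤n)) sa₁ isa₁ read-side₁ ones

    -- each side needs at least its length, and together they fill [1, n]
    Znew-zeros : rank Znew 0 n ≡ n₀
    Znew-zeros = ≤-antisym (+-cancelʳ-≤ n₁ (rank Znew 0 n) n₀
      (≤-trans (+-monoʳ-≤ (rank Znew 0 n) LF₁.side-size) (≤-reflexive (rank-sum Znew n Znew-binary))))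
      LF₀.side-size

    Znew-ones : rank Znew 1 n ≡ n₁
    Znew-ones = BitVector.ones Znew-binary Znew-zeros

    ctx-dest-sigma : ∀ k → 1 ≤ k → k ≤ n → 2 ≤ read k → ctx h Znew (dest k) ≡ read k ∷ ctx h' Zp k
    ctx-dest-sigma k p q big with bit k p q
    ... | inj₁ z = LF₀.ctx-dest-sigma Znew-zeros ctx-side₀ k p q z big
    ... | inj₂ z = LF₁.ctx-dest-sigma Znew-ones ctx-side₁ k p q z big

    written-ctx : ℕ → Bool → List ℕ
    written-ctx k continues = read k ∷ (if continues then ctx h' Zp k else [])

    ctx-dest : ∀ k → 1 ≤ k → k ≤ n → ctx h Znew (dest k) ≡ written-ctx k (2 ≤ᵇ read k)
    ctx-dest k p q with le2-view (read k) | bit k p q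
    ... | inj₁ (e , big) | _ = trans (ctx-dest-sigma k p q big) (cong (written-ctx k) (sym e))
    ... | inj₂ (e , sm) | inj₁ z = trans (LF₀.ctx-dest-dollar Znew-zeros ctx-side₀ k p q z sm) (cong (written-ctx k) (sym e))
    ... | inj₂ (e , sm) | inj₂ z = trans (LF₁.ctx-dest-dollar Znew-ones ctx-side₁ k p q z sm) (cong (written-ctx k) (sym e))

    -- Z^(h) is sorted by length-h contexts: compare first symbols, then (for
    -- equal Σ-symbols) the old contexts, sorted by the invariant for h'
    Znew-sorted : SortedContexts h Znew
    Znew-sorted p p' a b c with m≤n⇒m<n∨m≡n b
    ... | inj₂ refl = inj₂ refl
    ... | inj₁ plt with dest-onto p a (≤-trans b c) | dest-onto p' (≤-trans a b) c
    ...   | (k , k1 , k2 , refl) | (k' , k1' , k2' , refl)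
      rewrite ctx-dest k k1 k2 | ctx-dest k' k1' k2' with <-cmp (read k) (read k')
    ...     | tri< x _ _ = inj₁ (this x)
    ...     | tri> _ _ x = ⊥-elim (<⇒≱ plt (<⇒≤ (dest-lt-symbol k' k k1' k2' k1 k2 x)))
    ...     | tri≈ _ e _ with le2-view (read k)
    ...       | inj₂ (_ , sm) = ⊥-elim (<⇒≢ plt (cong dest (dollar-once k k' k1 k2 k1' k2' e sm)))
    ...       | inj₁ (e2 , big) with <-cmp k k'
    ...         | tri≈ _ x _ = ⊥-elim (<⇒≢ plt (cong dest x))
    ...         | tri> _ _ x = ⊥-elim (<⇒≱ plt (<⇒≤ (dest-lt-step k' k k1' k2 (sym e) (subst (2 ≤_) e big) x)))
    ...         | tri< x _ _ rewrite e2 | sym e | e2 = ≼-cons (read k) (sorted k k' k1 (<⇒≤ x) k2')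

    Znew-inv : ZInvariant h Znew
    Znew-inv = record { binary = Znew-binary ; zeros = Znew-zeros ; sorted = Znew-sorted }

    -- Block ids track the blocks of Z^(h'): by the invariant for h' and the
    -- alignment, step q starts a block exactly when the level-h' keys of the
    -- suffixes at positions q-1 and q differ.

    prevKey : ℕ → List ℕ
    prevKey q = key-of h' (sa₀₁ q)

    starts⇒keys-differ : ∀ q → 2 ≤ q → q ≤ n → starts q ≡ true → prevKey (q ∸ 1) ≢ prevKey q
    starts⇒keys-differ q 2≤q q≤n st =
      boundary-keys-differ h' q 2≤q q≤n
        (marked⇒boundary q (≤-trans (s≤s z≤n) 2≤q) (m≤n⇒m≤1+n q≤n) (nonzero (∧-left {not (Bp q ≡ᵇ 0)} st)))
      where
      nonzero : not (Bp q ≡ᵇ 0) ≡ true → Bp q ≢ 0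
      nonzero e z rewrite z with () ← e

    keys-differ⇒starts : ∀ q → 2 ≤ q → q ≤ n → prevKey (q ∸ 1) ≢ prevKey q → starts q ≡ true
    keys-differ⇒starts q 2≤q q≤n d =
      ∧-intro (nonzero (boundary⇒marked q (≤-trans (s≤s z≤n) 2≤q) (m≤n⇒m≤1+n q≤n) (inj₂ (inj₂ (2≤q , q≤n , d)))))
              not-new
      where
      nonzero : Bp q ≢ 0 → not (Bp q ≡ᵇ 0) ≡ true
      nonzero ne rewrite eqb-neq ne = refl
      -- a mark h from iteration h' is only possible for h' = 0, where all keys agree
      not-new : not (Bp q ≡ᵇ h) ≡ true
      not-new with eqbView (Bp q) h
      ... | neqv _ b rewrite b = refl
      ... | eqv e _ with mark-top q e
      ...   | refl = ⊥-elim (d refl)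

    keys-agree-unless-starts : ∀ q → 2 ≤ q → q ≤ n → starts q ≡ false → prevKey (q ∸ 1) ≡ prevKey q
    keys-agree-unless-starts q 2≤q q≤n st with ≡-dec _≟_ (prevKey (q ∸ 1)) (prevKey q)
    ... | yes e = e
    ... | no ne with () ← trans (sym (keys-differ⇒starts q 2≤q q≤n ne)) st

    idAt-value : ∀ K → Σ ℕ λ m → idAt K ≡ + m × m ≤ K
    idAt-value zero = 0 , refl , z≤n
    idAt-value (suc K) with starts (suc K)
    ... | true = suc K , refl , ≤-refl
    ... | false = let (m , e , le) = idAt-value K in m , e , m≤n⇒m≤1+n le

    same-id⇒same-key : ∀ k k' → 1 ≤ k → k ≤ k' → k' ≤ n → idAt k ≡ idAt k' → prevKey k ≡ prevKey k'
    same-id⇒same-key k k' p le qn e with m≤n⇒m<n∨m≡n le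
    ... | inj₂ refl = refl
    ... | inj₁ lt with k' | lt
    ...   | suc K | s≤s kK with starts (suc K) in st
    ...     | true = let (m , em , mle) = idAt-value k in
                     ⊥-elim (<⇒≱ (s≤s kK) (≤-trans (≤-reflexive (+-injective (trans (sym e) em))) mle))
    ...     | false = trans (same-id⇒same-key k K p kK (≤-trans (n≤1+n K) qn) e)
                            (keys-agree-unless-starts (suc K) (s≤s (≤-trans p kK)) qn st)

    same-key⇒same-id : ∀ k k' → 1 ≤ k → k ≤ k' → k' ≤ n → prevKey k ≡ prevKey k' → idAt k ≡ idAt k'
    same-key⇒same-id k k' p le qn e with m≤n⇒m<n∨m≡n le
    ... | inj₂ refl = refl
    ... | inj₁ lt with k' | lt
    ...   | suc K | s≤s kK with starts (suc K) in st
    ...     | false = same-key⇒same-id k K p kK (≤-trans (n≤1+n K) qn) (≼-antisym k≼K (≼-trans K≼K+1 K+1≼k))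
      where
      k≼K = sa₀₁-sorted h' k K p kK (≤-trans (n≤1+n K) qn)
      K≼K+1 = sa₀₁-sorted h' K (suc K) (≤-trans p kK) (n≤1+n K) qn
      K+1≼k : prevKey (suc K) ≼ prevKey k
      K+1≼k = inj₂ (sym e)
    ...     | true = ⊥-elim (starts⇒keys-differ (suc K) (s≤s (≤-trans p kK)) qn st (≼-antisym K≼K+1 (≼-trans K+1≼k k≼K)))
      where
      k≼K = sa₀₁-sorted h' k K p kK (≤-trans (n≤1+n K) qn)
      K≼K+1 = sa₀₁-sorted h' K (suc K) (≤-trans p kK) (n≤1+n K) qn
      K+1≼k : prevKey (suc K) ≼ prevKey k
      K+1≼k = inj₂ (sym e)

    lastId-none : ∀ c K → occ c K ≡ 0 → lastId c K ≡ -[1+ 0 ]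
    lastId-none c zero _ = refl
    lastId-none c (suc K) e with eqbView (read (suc K)) c
    ... | eqv x _ = ⊥-elim (1+n≢0 (trans (sym (rank-suc-eq read c K x)) e))
    ... | neqv ne b rewrite b = lastId-none c K (trans (sym (rank-suc-neq read c K ne)) e)

    lastId-last : ∀ c K m → occ c K ≡ suc m →
      Σ ℕ λ k' → 1 ≤ k' × k' ≤ K × read k' ≡ c × occ c (k' ∸ 1) ≡ m × lastId c K ≡ idAt k'
    lastId-last c zero m ()
    lastId-last c (suc K) m e with eqbView (read (suc K)) c
    ... | eqv x b rewrite b = suc K , s≤s z≤n , ≤-refl , x , suc-injective (trans (sym (rank-suc-eq read c K x)) e) , refl
    ... | neqv ne b rewrite b =
      let (k' , a1 , a2 , a3 , a4 , a5) = lastId-last c K m (trans (sym (rank-suc-neq read c K ne)) e) in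
      k' , a1 , m≤n⇒m≤1+n a2 , a3 , a4 , a5

    occ-zero : ∀ c K → (∀ k → 1 ≤ k → k ≤ K → read k ≢ c) → occ c K ≡ 0
    occ-zero c zero _ = refl
    occ-zero c (suc K) f =
      trans (rank-suc-neq read c K (f (suc K) (s≤s z≤n) ≤-refl)) (occ-zero c K (λ k a b → f k a (m≤n⇒m≤1+n b)))

    occ-pos : ∀ c K k → 1 ≤ k → k ≤ K → read k ≡ c → 1 ≤ occ c K
    occ-pos c K k a b e = ≤-trans (rank-pos read c a e) (rank-mono read c b)

    first-read-fresh : ∀ K → lastId (read (suc K)) K ≡ -[1+ 0 ] → fresh (suc K) ≡ true
    first-read-fresh K e rewrite e with -[1+ 0 ] ℤ.≟ idAt (suc K)
    ... | no _ = refl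
    ... | yes x = let (m , em , _) = idAt-value (suc K) in ⊥-elim (neg≢pos (trans x em))
      where
      neg≢pos : ∀ {m} → -[1+ 0 ] ≢ + m
      neg≢pos ()

    later-read-fresh : ∀ K k' → lastId (read (suc K)) K ≡ idAt k' →
      (fresh (suc K) ≡ true → idAt k' ≢ idAt (suc K)) × (idAt k' ≢ idAt (suc K) → fresh (suc K) ≡ true)
    later-read-fresh K k' e rewrite e with idAt k' ℤ.≟ idAt (suc K)
    ... | yes x = (λ ()) , (λ ne → ⊥-elim (ne x))
    ... | no ne = (λ _ → ne) , (λ _ → refl)

    ctx-differs⇒boundary : ∀ p → 2 ≤ p → p ≤ n → ctx h Znew (p ∸ 1) ≢ ctx h Znew p → Boundary h p
    ctx-differs⇒boundary = ctx-differs⇒boundary-at Znew-inv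

    boundary⇒ctx-differs : ∀ p → 2 ≤ p → p ≤ n → Boundary h p → ctx h Znew (p ∸ 1) ≢ ctx h Znew p
    boundary⇒ctx-differs = boundary⇒ctx-differs-at Znew-inv

    heads-differ : ∀ {x y : ℕ} {xs ys} → x ≢ y → (x ∷ xs) ≢ (y ∷ ys)
    heads-differ ne e = ne (∷-injectiveˡ e)

    -- c is a $: it is read for the first time, and dest k ∈ {1, 2} is a
    -- boundary (for dest k = 2, position 1 carries the context $₀, written by the
    -- step k-first, and position 2 the context $₁)
    module DollarStep (K : ℕ) (K<n : suc K ≤ n) (dollar : read (suc K) < 2)
      (k-first : ℕ) (1≤k-first : 1 ≤ k-first) (k-first≤n : k-first ≤ n) (dest-k-first : dest k-first ≡ 1) where
      k : ℕ
      k = suc K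
      1≤k : 1 ≤ k
      1≤k = s≤s z≤n

      fresh-k : fresh k ≡ true
      fresh-k = first-read-fresh K (lastId-none (read k) K (occ-zero (read k) K earlier-not-c))
        where
        earlier-not-c : ∀ k'' → 1 ≤ k'' → k'' ≤ K → read k'' ≢ read k
        earlier-not-c k'' a b e = <⇒≢ (s≤s b)
          (dollar-once k'' k a (≤-trans (≤-trans b (n≤1+n K)) K<n) 1≤k K<n e (subst (_< 2) (sym e) dollar))

      dest-k : Zp k ≡ 1 → dest k ≡ 2
      dest-k z = trans (dest-dollar k dollar) (cong suc z)

      k-first-dollar : read k-first < 2
      k-first-dollar with le2-view (read k-first)
      ... | inj₂ (_ , s) = s
      ... | inj₁ (_ , b) = ⊥-elim (<⇒≱ (≤-trans (s≤s (s≤s z≤n)) (dest≥3 k-first b)) (≤-reflexive dest-k-first))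

      read-k-first : read k-first ≡ 0
      read-k-first = trans (dollar-read k-first 1≤k-first k-first≤n k-first-dollar)
                           (suc-injective (trans (sym (dest-dollar k-first k-first-dollar)) dest-k-first))

      ctx-1≢ctx-2 : Zp k ≡ 1 → ctx h Znew 1 ≢ ctx h Znew 2
      ctx-1≢ctx-2 z e = heads-differ $₀≢$₁
        (trans (sym (ctx-dest k-first 1≤k-first k-first≤n))
          (trans (cong (ctx h Znew) dest-k-first) (trans e (trans (cong (ctx h Znew) (sym (dest-k z))) (ctx-dest k 1≤k K<n)))))
        where
        $₀≢$₁ : read k-first ≢ read k
        $₀≢$₁ x = 0≢1+n (trans (sym read-k-first) (trans x (trans (dollar-read k 1≤k K<n dollar) z)))

      boundary : Boundary h (dest k)
      boundary with bit k 1≤k K<n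
      ... | inj₁ z = subst (Boundary h) (sym (trans (dest-dollar k dollar) (cong suc z))) (inj₁ refl)
      ... | inj₂ z = subst (Boundary h) (sym (dest-k z)) (ctx-differs⇒boundary 2 ≤-refl n≥2 (ctx-1≢ctx-2 z))

    -- c ∈ Σ is read for the first time: fresh, and dest k = F-init c is a
    -- boundary since position dest k - 1, written by step k'', carries a smaller
    -- symbol
    module FirstOccurrence (K : ℕ) (K<n : suc K ≤ n) (c∈Σ : 2 ≤ read (suc K)) (first : occ (read (suc K)) K ≡ 0)
      (k'' : ℕ) (1≤k'' : 1 ≤ k'') (k''≤n : k'' ≤ n) (dest-k'' : dest k'' ≡ dest (suc K) ∸ 1) where
      k : ℕ
      k = suc K
      1≤k : 1 ≤ k
      1≤k = s≤s z≤n
      c : ℕ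
      c = read k

      fresh-k : fresh k ≡ true
      fresh-k = first-read-fresh K (lastId-none c K first)

      3≤dest : 3 ≤ dest k
      3≤dest = dest≥3 k c∈Σ

      dest-lt : dest k'' < dest k
      dest-lt = subst (_< dest k) (sym dest-k'')
        (≤-reflexive (suc-pred (dest k) {{>-nonZero (≤-trans (s≤s z≤n) 3≤dest)}}))

      smaller : read k'' < c
      smaller with <-cmp (read k'') c
      ... | tri< x _ _ = x
      ... | tri> _ _ x = ⊥-elim (<⇒≱ dest-lt (<⇒≤ (dest-lt-symbol k k'' 1≤k K<n 1≤k'' k''≤n x)))
      ... | tri≈ _ x _ with <-cmp k'' k
      ...   | tri< y _ _ = ⊥-elim (<⇒≱ (occ-pos c K k'' 1≤k'' (≤-pred y) x) (≤-reflexive first))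
      ...   | tri≈ _ y _ = ⊥-elim (<⇒≢ dest-lt (cong dest y))
      ...   | tri> _ _ y = ⊥-elim (<⇒≱ dest-lt (<⇒≤ (dest-lt-step k k'' 1≤k k''≤n (sym x) c∈Σ y)))

      boundary : Boundary h (dest k)
      boundary = ctx-differs⇒boundary (dest k) (≤-trans (s≤s (s≤s z≤n)) 3≤dest) (proj₂ (dest-range k 1≤k K<n))
        (λ e → heads-differ (<⇒≢ smaller)
          (trans (sym (ctx-dest k'' 1≤k'' k''≤n)) (trans (cong (ctx h Znew) dest-k'') (trans e (ctx-dest k 1≤k K<n)))))

    -- c ∈ Σ was last read at step k' < k: then dest k' = dest k - 1 and the
    -- contexts written are c·ctx(k') and c·ctx(k); the test compares the ids of
    -- k' and k, which agree iff the old contexts do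
    module LaterOccurrence (K : ℕ) (K<n : suc K ≤ n) (c∈Σ : 2 ≤ read (suc K)) (m : ℕ)
      (again : occ (read (suc K)) K ≡ suc m)
      (k' : ℕ) (1≤k' : 1 ≤ k') (k'≤K : k' ≤ K) (read-k' : read k' ≡ read (suc K))
      (occ-k' : occ (read (suc K)) (k' ∸ 1) ≡ m) (lastId-k' : lastId (read (suc K)) K ≡ idAt k') where
      k : ℕ
      k = suc K
      1≤k : 1 ≤ k
      1≤k = s≤s z≤n
      c : ℕ
      c = read k

      k'≤n : k' ≤ n
      k'≤n = ≤-trans k'≤K (≤-trans (n≤1+n K) K<n)

      dest-pred : dest k ∸ 1 ≡ dest k'
      dest-pred = trans (cong (_∸ 1) (trans dest-k (+-suc (F-init c) m))) (sym dest-k')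
        where
        dest-k' : dest k' ≡ F-init c + m
        dest-k' = trans (dest-sigma k' (subst (2 ≤_) (sym read-k') c∈Σ))
          (trans (cong (λ z → F-init z + occ z (k' ∸ 1)) read-k') (cong (λ z → F-init c + z) occ-k'))
        dest-k : dest k ≡ F-init c + suc m
        dest-k = trans (dest-sigma k c∈Σ) (cong (λ z → F-init c + z) again)

      2≤dest : 2 ≤ dest k
      2≤dest = ≤-trans (s≤s (s≤s z≤n)) (dest≥3 k c∈Σ)

      dest≤n : dest k ≤ n
      dest≤n = proj₂ (dest-range k 1≤k K<n)

      ctx-k' : ctx h Znew (dest k') ≡ c ∷ ctx h' Zp k'
      ctx-k' = trans (ctx-dest-sigma k' 1≤k' k'≤n (subst (2 ≤_) (sym read-k') c∈Σ)) (cong (_∷ ctx h' Zp k') read-k')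

      ctx-k : ctx h Znew (dest k) ≡ c ∷ ctx h' Zp k
      ctx-k = ctx-dest-sigma k 1≤k K<n c∈Σ

      old-ctx-k' : ctx h' Zp k' ≡ prevKey k'
      old-ctx-k' = ctx-aligned z-inv k' 1≤k' k'≤n

      old-ctx-k : ctx h' Zp k ≡ prevKey k
      old-ctx-k = ctx-aligned z-inv k 1≤k K<n

      fresh⇒boundary : fresh k ≡ true → Boundary h (dest k)
      fresh⇒boundary new = ctx-differs⇒boundary (dest k) 2≤dest dest≤n
        (λ e → old-differ (∷-injectiveʳ (trans (sym ctx-k') (trans (cong (ctx h Znew) (sym dest-pred)) (trans e ctx-k)))))
        where
        old-differ : ctx h' Zp k' ≢ ctx h' Zp k
        old-differ e = proj₁ (later-read-fresh K k' lastId-k') new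
          (same-key⇒same-id k' k 1≤k' (≤-trans k'≤K (n≤1+n K)) K<n (trans (sym old-ctx-k') (trans e old-ctx-k)))

      boundary⇒fresh : Boundary h (dest k) → fresh k ≡ true
      boundary⇒fresh bd = proj₂ (later-read-fresh K k' lastId-k') λ e →
        boundary⇒ctx-differs (dest k) 2≤dest dest≤n bd
          (trans (cong (ctx h Znew) dest-pred) (trans ctx-k' (trans (cong (c ∷_)
            (trans old-ctx-k' (trans (same-id⇒same-key k' k 1≤k' (≤-trans k'≤K (n≤1+n K)) K<n e) (sym old-ctx-k))))
            (sym ctx-k))))

    fresh⇔boundary : ∀ k → 1 ≤ k → k ≤ n →
      (fresh k ≡ true → Boundary h (dest k)) × (Boundary h (dest k) → fresh k ≡ true)
    fresh⇔boundary (suc K) _ K<n with le2-view (read (suc K))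
    ... | inj₂ (_ , dollar) =
      let (k₁ , a , b , e) = dest-onto 1 ≤-refl (≤-trans (s≤s z≤n) n≥2) in
      (λ _ → DollarStep.boundary K K<n dollar k₁ a b e) , (λ _ → DollarStep.fresh-k K K<n dollar k₁ a b e)
    ... | inj₁ (_ , c∈Σ) with zero-or-suc (occ (read (suc K)) K)
    ...   | inj₁ occurrences =
      let 3≤dest = dest≥3 (suc K) c∈Σ
          dest-suc = sym (suc-pred (dest (suc K)) {{>-nonZero (≤-trans (s≤s z≤n) 3≤dest)}})
          (k'' , a , b , e) = dest-onto (dest (suc K) ∸ 1) (≤-trans (s≤s z≤n) (≤-pred (≤-trans 3≤dest (≤-reflexive dest-suc))))
                                        (≤-trans (m∸n≤m (dest (suc K)) 1) (proj₂ (dest-range (suc K) (s≤s z≤n) K<n)))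
      in (λ _ → FirstOccurrence.boundary K K<n c∈Σ occurrences k'' a b e) ,
         (λ _ → FirstOccurrence.fresh-k K K<n c∈Σ occurrences k'' a b e)
    ...   | inj₂ (m , occurrences) =
      let (k' , a , b , c , d , e) = lastId-last (read (suc K)) K m occurrences in
      LaterOccurrence.fresh⇒boundary K K<n c∈Σ m occurrences k' a b c d e ,
      LaterOccurrence.boundary⇒fresh K K<n c∈Σ m occurrences k' a b c d e

    Bnew : ℕ → ℕ
    Bnew = Bafter n

    new-marks-are-boundaries : ∀ p → 1 ≤ p → p ≤ suc n → Bnew p ≢ 0 → Boundary h p
    new-marks-are-boundaries p a b ne with marks-sourced n ≤-refl p ne
    ... | inj₁ x = boundary-refine h' h p (n≤1+n h') (marked⇒boundary p a b x)
    ... | inj₂ (k , x , y , e , new) = subst (Boundary h) e (proj₁ (fresh⇔boundary k x y) new)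

    boundaries-are-new-marks : ∀ p → 1 ≤ p → p ≤ suc n → Boundary h p → Bnew p ≢ 0
    boundaries-are-new-marks p a b bd with m≤n⇒m<n∨m≡n b
    ... | inj₂ refl = marks-kept n ≤-refl (suc n) (boundary⇒marked (suc n) (s≤s z≤n) ≤-refl (inj₂ (inj₁ refl)))
    ... | inj₁ (s≤s b') = let (k , x , y , e) = dest-onto p a b' in
      subst (λ z → Bnew z ≢ 0) e
        (marks-set n ≤-refl k x y (proj₂ (fresh⇔boundary k x y) (subst (Boundary h) (sym e) bd)))

    new-mark-≤ : ∀ p → Bnew p ≤ h
    new-mark-≤ p with B-values n ≤-refl p
    ... | inj₁ e = subst (_≤ h) (sym e) (mark-≤ p)
    ... | inj₂ (_ , e) = ≤-reflexive e

    step-invariant : Invariant h Znew Bnew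
    step-invariant = record
      { z-inv = Znew-inv
      ; marked⇒boundary = new-marks-are-boundaries
      ; boundary⇒marked = boundaries-are-new-marks
      ; mark-≤ = λ p → m≤n⇒m≤1+n (new-mark-≤ p)
      ; mark-top = λ p e → ⊥-elim (<⇒≱ (s≤s ≤-refl) (subst (_≤ h) e (new-mark-≤ p)))
      }

  state-at : ℕ → (ℕ → ℕ) × (ℕ → ℕ)
  state-at h = run h n₀ n₁ (bwt t₀ sa₀) (bwt t₁ sa₁)

  Z⁰ : ℕ → ℕ
  Z⁰ = proj₁ (state-at 0)

  B⁰ : ℕ → ℕ
  B⁰ = proj₂ (state-at 0)

  Z⁰-prefix : ∀ K → K ≤ n₀ → rank Z⁰ 0 K ≡ K
  Z⁰-prefix zero _ = refl
  Z⁰-prefix (suc K) le =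
    trans (rank-suc-eq Z⁰ 0 K zero-bit) (cong suc (Z⁰-prefix K (≤-trans (n≤1+n K) le)))
    where
    zero-bit : Z⁰ (suc K) ≡ 0
    zero-bit rewrite ltb-true {K} {n₀} le = refl

  Z⁰-zeros : ∀ d → rank Z⁰ 0 (n₀ + d) ≡ n₀
  Z⁰-zeros zero = trans (cong (rank Z⁰ 0) (+-identityʳ n₀)) (Z⁰-prefix n₀ ≤-refl)
  Z⁰-zeros (suc d) = trans (cong (rank Z⁰ 0) (+-suc n₀ d))
    (trans (rank-suc-neq Z⁰ 0 (n₀ + d) one) (Z⁰-zeros d))
    where
    one : Z⁰ (suc (n₀ + d)) ≢ 0
    one rewrite ltb-false {n₀ + d} {n₀} (m≤m+n n₀ d) = λ ()

  Z⁰-binary : Binary Z⁰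
  Z⁰-binary p _ _ with p ≤ᵇ n₀
  ... | true = z≤n
  ... | false = ≤-refl

  ctx-zero : ∀ Z p → ctx 0 Z p ≡ []
  ctx-zero Z p with Z p ≡ᵇ 0
  ... | true = refl
  ... | false = refl

  initial-invariant : Invariant 0 Z⁰ B⁰
  initial-invariant = record
    { z-inv = record { binary = Z⁰-binary ; zeros = Z⁰-zeros n₁
                     ; sorted = λ p p' _ _ _ → inj₂ (trans (ctx-zero Z⁰ p) (sym (ctx-zero Z⁰ p'))) }
    ; marked⇒boundary = marked⇒ends
    ; boundary⇒marked = ends⇒marked
    ; mark-≤ = mark-≤1
    ; mark-top = λ _ _ → refl
    }
    where
    marked⇒ends : ∀ p → 1 ≤ p → p ≤ suc n → B⁰ p ≢ 0 → Boundary 0 p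
    marked⇒ends p _ _ ne with eqbView p 1 | eqbView p (suc n)
    ... | eqv e _ | _ = inj₁ e
    ... | neqv _ _ | eqv e _ = inj₂ (inj₁ e)
    ... | neqv _ b | neqv _ b' rewrite b | b' = ⊥-elim (ne refl)
    ends⇒marked : ∀ p → 1 ≤ p → p ≤ suc n → Boundary 0 p → B⁰ p ≢ 0
    ends⇒marked p _ _ (inj₁ refl) ()
    ends⇒marked p _ _ (inj₂ (inj₁ refl)) rewrite eqb-refl (suc n) with suc n ≡ᵇ 1
    ... | true = λ ()
    ... | false = λ ()
    ends⇒marked p _ _ (inj₂ (inj₂ (_ , _ , d))) = ⊥-elim (d refl)
    mark-≤1 : ∀ p → B⁰ p ≤ 1
    mark-≤1 p with (p ≡ᵇ 1) ∨ (p ≡ᵇ suc n)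
    ... | true = ≤-refl
    ... | false = z≤n

  invariant : ∀ h → Invariant h (proj₁ (state-at h)) (proj₂ (state-at h))
  invariant zero = initial-invariant
  invariant (suc h) = Step.step-invariant h _ _ (invariant h)

  module LcpEntry (i : ℕ) (a : 2 ≤ i) (b : i ≤ n) where
    lcp-entry : lcpArr t₀₁ sa₀₁ i ≡ + lcpLen (suffix t₀₁ (sa₀₁ (i ∸ 1))) (suffix t₀₁ (sa₀₁ i))
    lcp-entry rewrite eqb-neq {i} {1} (λ e → <⇒≢ a (sym e))
                    | eqb-neq {i} {suc (length t₀₁)}
                        (λ e → <⇒≱ (s≤s b) (≤-reflexive (trans (sym (cong suc length-t₀₁)) (sym e)))) = refl

    ra : 1 ≤ sa₀₁ (i ∸ 1) × sa₀₁ (i ∸ 1) ≤ n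
    ra = sa₀₁-range (i ∸ 1) (pred-pos a) (≤-trans (m∸n≤m i 1) b)

    rb : 1 ≤ sa₀₁ i × sa₀₁ i ≤ n
    rb = sa₀₁-range i (≤-trans (s≤s z≤n) a) b

    distinct : suffix t₀₁ (sa₀₁ (i ∸ 1)) ≢ suffix t₀₁ (sa₀₁ i)
    distinct e = <⇒≢ (∸-monoʳ-< {i} {1} {0} (s≤s z≤n) (≤-trans (s≤s z≤n) a))
      (sa₀₁-inj (i ∸ 1) i (pred-pos a) (≤-trans (m∸n≤m i 1) b) (≤-trans (s≤s z≤n) a) b
        (suffix-injective t₀₁ _ _ (proj₁ ra) (subst (_ ≤_) (sym length-t₀₁) (proj₂ ra))
                                  (proj₁ rb) (subst (_ ≤_) (sym length-t₀₁) (proj₂ rb)) e))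

    lcp<⇒keys-differ : ∀ h → lcpArr t₀₁ sa₀₁ i ℤ.< + h → key-of h (sa₀₁ (i ∸ 1)) ≢ key-of h (sa₀₁ i)
    lcp<⇒keys-differ h lt e with subst (ℤ._< + h) lcp-entry lt
    ... | ℤ.+<+ x = <⇒≱ x (take-lcp h _ _ sa sb distinct (key-inj h _ _ sa sb e))
      where
      sa = suffix-shape (sa₀₁ (i ∸ 1)) (proj₁ ra) (proj₂ ra)
      sb = suffix-shape (sa₀₁ i) (proj₁ rb) (proj₂ rb)

    lcp≥⇒keys-agree : ∀ h → + h ℤ.≤ lcpArr t₀₁ sa₀₁ i → key-of h (sa₀₁ (i ∸ 1)) ≡ key-of h (sa₀₁ i)
    lcp≥⇒keys-agree h ge with subst (+ h ℤ.≤_) lcp-entry ge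
    ... | ℤ.+≤+ x = cong cut (lcp-take h _ _ x)

  lcp<⇒boundary : ∀ h i → 1 ≤ i → i ≤ suc n → lcpArr t₀₁ sa₀₁ i ℤ.< + h → Boundary h i
  lcp<⇒boundary h (suc zero) _ _ _ = inj₁ refl
  lcp<⇒boundary h (suc (suc i)) _ le lt with m≤n⇒m<n∨m≡n le
  ... | inj₂ e = inj₂ (inj₁ e)
  ... | inj₁ (s≤s le') = inj₂ (inj₂ (s≤s (s≤s z≤n) , le' ,
                          LcpEntry.lcp<⇒keys-differ (suc (suc i)) (s≤s (s≤s z≤n)) le' h lt))

  module Block (h ℓ m : ℕ) (1≤ℓ : 1 ≤ ℓ) (ℓ≤m : ℓ ≤ m) (m≤n : m ≤ n)
    (left  : lcpArr t₀₁ sa₀₁ ℓ ℤ.< + h)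
    (inner : ∀ i → suc ℓ ≤ i → i ≤ m → + h ℤ.≤ lcpArr t₀₁ sa₀₁ i)
    (right : lcpArr t₀₁ sa₀₁ (suc m) ℤ.< + h) where
    open Invariant (invariant h)
    Z B : ℕ → ℕ
    Z = proj₁ (state-at h)
    B = proj₂ (state-at h)

    inner-no-boundary : ∀ i → suc ℓ ≤ i → i ≤ m → ¬ Boundary h i
    inner-no-boundary i a b bd = boundary-keys-differ h i (≤-trans (s≤s 1≤ℓ) a) (≤-trans b m≤n) bd
      (LcpEntry.lcp≥⇒keys-agree i (≤-trans (s≤s 1≤ℓ) a) (≤-trans b m≤n) h (inner i a b))

    B-left : B ℓ ≢ 0
    B-left = boundary⇒marked ℓ 1≤ℓ (≤-trans ℓ≤m (m≤n⇒m≤1+n m≤n))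
               (lcp<⇒boundary h ℓ 1≤ℓ (≤-trans ℓ≤m (m≤n⇒m≤1+n m≤n)) left)

    B-inner : ∀ i → suc ℓ ≤ i → i ≤ m → B i ≡ 0
    B-inner i a b with B i ≟ 0
    ... | yes e = e
    ... | no ne = ⊥-elim (inner-no-boundary i a b
            (marked⇒boundary i (≤-trans (s≤s z≤n) a) (≤-trans b (m≤n⇒m≤1+n m≤n)) ne))

    B-right : B (suc m) ≢ 0
    B-right = boundary⇒marked (suc m) (s≤s z≤n) (s≤s m≤n)
                (lcp<⇒boundary h (suc m) (s≤s z≤n) (s≤s m≤n) right)

    constant-key : ∀ p → ℓ ≤ p → p ≤ m → key-of h (sa₀₁ p) ≡ key-of h (sa₀₁ ℓ)
    constant-key p a b with m≤n⇒m<n∨m≡n a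
    ... | inj₂ refl = refl
    ... | inj₁ lt with p | lt
    ...   | suc p' | s≤s q = trans
            (sym (LcpEntry.lcp≥⇒keys-agree (suc p') (s≤s (≤-trans 1≤ℓ q)) (≤-trans b m≤n) h (inner (suc p') (s≤s q) b)))
            (constant-key p' q (≤-trans (n≤1+n p') b))

    same-context : SameContext t₀ t₁ sa₀ sa₁ h Z ℓ m
    same-context p q a b c d =
      trans (ctx-aligned z-inv p (≤-trans 1≤ℓ a) (≤-trans b m≤n))
        (trans (constant-key p a b)
          (trans (sym (constant-key q c d)) (sym (ctx-aligned z-inv q (≤-trans 1≤ℓ c) (≤-trans d m≤n)))))

    -- a same-context interval cannot cross the boundaries at ℓ and m+1
    maximal : ∀ ℓ' m' → 1 ≤ ℓ' → ℓ' ≤ ℓ → m ≤ m' → m' ≤ n →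
      SameContext t₀ t₁ sa₀ sa₁ h Z ℓ' m' → ℓ' ≡ ℓ × m' ≡ m
    maximal ℓ' m' a b c d sc = left-end , right-end
      where
      left-end : ℓ' ≡ ℓ
      left-end with m≤n⇒m<n∨m≡n b
      ... | inj₂ e = e
      ... | inj₁ lt = ⊥-elim (boundary⇒ctx-differs-at z-inv ℓ ℓ≥2 (≤-trans ℓ≤m m≤n)
              (lcp<⇒boundary h ℓ 1≤ℓ (≤-trans ℓ≤m (m≤n⇒m≤1+n m≤n)) left)
              (sc (ℓ ∸ 1) ℓ (≤-pred (≤-trans lt (≤-reflexive (sym (suc-pred ℓ {{>-nonZero 1≤ℓ}})))))
                  (≤-trans (m∸n≤m ℓ 1) (≤-trans ℓ≤m c)) b (≤-trans ℓ≤m c)))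
        where
        ℓ≥2 : 2 ≤ ℓ
        ℓ≥2 = ≤-trans (s≤s a) lt
      right-end : m' ≡ m
      right-end with m≤n⇒m<n∨m≡n c
      ... | inj₂ e = sym e
      ... | inj₁ lt = ⊥-elim (boundary⇒ctx-differs-at z-inv (suc m) (s≤s (≤-trans 1≤ℓ ℓ≤m)) (≤-trans lt d)
              (lcp<⇒boundary h (suc m) (s≤s z≤n) (s≤s m≤n) right)
              (sc m (suc m) (≤-trans b ℓ≤m) c (≤-trans b (≤-trans ℓ≤m (n≤1+n m))) lt))

    block : IsBlock t₀ t₁ sa₀ sa₁ n h Z ℓ m
    block = (1≤ℓ , ℓ≤m , m≤n) , same-context , maximal

lemma2 : (σ : ℕ) (u₀ u₁ : List ℕ) →
    All (λ c → 2 ≤ c × c ≤ suc σ) u₀ →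
    All (λ c → 2 ≤ c × c ≤ suc σ) u₁ →
    (sa₀ sa₁ sa₀₁ : ℕ → ℕ) →
    IsSuffixArray (u₀ ++ 0 ∷ []) sa₀ →
    IsSuffixArray (u₁ ++ 1 ∷ []) sa₁ →
    IsSuffixArray ((u₀ ++ 0 ∷ []) ++ (u₁ ++ 1 ∷ [])) sa₀₁ →
    (h ℓ m : ℕ) →
    1 ≤ ℓ → ℓ ≤ m → m ≤ length (u₀ ++ 0 ∷ []) + length (u₁ ++ 1 ∷ []) →
    lcpArr ((u₀ ++ 0 ∷ []) ++ (u₁ ++ 1 ∷ [])) sa₀₁ ℓ ℤ.< + h →
    (∀ i → suc ℓ ≤ i → i ≤ m →
       + h ℤ.≤ lcpArr ((u₀ ++ 0 ∷ []) ++ (u₁ ++ 1 ∷ [])) sa₀₁ i) →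
    lcpArr ((u₀ ++ 0 ∷ []) ++ (u₁ ++ 1 ∷ [])) sa₀₁ (suc m) ℤ.< + h →
    proj₂ (run h (length (u₀ ++ 0 ∷ [])) (length (u₁ ++ 1 ∷ []))
                 (bwt (u₀ ++ 0 ∷ []) sa₀) (bwt (u₁ ++ 1 ∷ []) sa₁)) ℓ ≢ 0 ×
    (∀ i → suc ℓ ≤ i → i ≤ m →
       proj₂ (run h (length (u₀ ++ 0 ∷ [])) (length (u₁ ++ 1 ∷ []))
                    (bwt (u₀ ++ 0 ∷ []) sa₀) (bwt (u₁ ++ 1 ∷ []) sa₁)) i ≡ 0) ×
    proj₂ (run h (length (u₀ ++ 0 ∷ [])) (length (u₁ ++ 1 ∷ []))
                 (bwt (u₀ ++ 0 ∷ []) sa₀) (bwt (u₁ ++ 1 ∷ []) sa₁)) (suc m) ≢ 0 ×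
    IsBlock (u₀ ++ 0 ∷ []) (u₁ ++ 1 ∷ []) sa₀ sa₁
      (length (u₀ ++ 0 ∷ []) + length (u₁ ++ 1 ∷ [])) h
      (proj₁ (run h (length (u₀ ++ 0 ∷ [])) (length (u₁ ++ 1 ∷ []))
                    (bwt (u₀ ++ 0 ∷ []) sa₀) (bwt (u₁ ++ 1 ∷ []) sa₁)))
      ℓ m
lemma2 σ u₀ u₁ alph₀ alph₁ sa₀ sa₁ sa₀₁ isa₀ isa₁ isa₀₁ h ℓ m 1≤ℓ ℓ≤m m≤n left inner right =
  B-left , B-inner , B-right , block
  where
  -- only the lower bound of the alphabet matters: no symbol of u₀, u₁ is a $
  open Setting u₀ u₁ (All.map proj₁ alph₀) (All.map proj₁ alph₁) sa₀ sa₁ sa₀₁ isa₀ isa₁ isa₀₁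
  open Block h ℓ m 1≤ℓ ℓ≤m m≤n left inner right
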